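{- For all $k\ge 2$, $$\sum_{n\ge0}\frac{t^n}{[n]_{p,q}!}\sum_{\substack{(\sigma,w)\in C_k\wr S_n\\ \mathrm{wris}(\sigma,w)=0}}q^{\mathrm{inv}(\sigma)}p^{\mathrm{coinv}(\sigma)}r^{\|w\|}=\frac{1}{1+\sum_{n\ge1}\frac{p^{\binom n2}(-t)^n}{[n]_{p,q}!}[k]_{r^n}}.$$
   Context: $C_k\wr S_n$ is identified with the set of pairs $(\sigma,w)$, $\sigma\in S_n$, $w=w_1\cdots w_n\in\{0,\dots,k-1\}^n$ (one empty element for $n=0$). $\mathrm{wris}(\sigma,w)=|\{i\le n-1:\sigma_i<\sigma_{i+1},\ w_i= w_{i+1}\}|$. $\mathrm{inv}(\sigma)=|\{a<b:\sigma_a>\sigma_b\}|$, $\mathrm{coinv}(\sigma)=|\{a<b:\sigma_a<\sigma_b\}|$, $\|w\|=w_1+\cdots+w_n$. $[n]_{p,q}=p^{n-1}+p^{n-2}q+\cdots+q^{n-1}$, $[n]_{p,q}!=[n]_{p,q}\cdots[1]_{p,q}$, $[k]_{r^n}=1+r^n+\cdots+r^{(k-1)n}$. -}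

module Defs where

open import Level using (Level)
import Data.Nat as N
open N using (ℕ; zero; suc; _∸_; _<?_)
open import Data.Nat.ListAction using (sum)
open import Data.Nat.Combinatorics using (_C_)
open import Data.List using (List; []; _∷_; length; filter; map; concatMap; upTo; zip)
open import Data.Product using (_×_; _,_)
open import Relation.Nullary using (yes; no)
open import Algebra.Bundles using (CommutativeRing)

insertEverywhere : ℕ → List ℕ → List (List ℕ)
insertEverywhere x []       = (x ∷ []) ∷ []
insertEverywhere x (y ∷ ys) = (x ∷ y ∷ ys) ∷ map (y ∷_) (insertEverywhere x ys)

perms : ℕ → List (List ℕ)
perms zero    = [] ∷ []
perms (suc n) = concatMap (insertEverywhere (suc n)) (perms n)

words : ℕ → ℕ → List (List ℕ)
words k zero    = [] ∷ []
words k (suc n) = concatMap (λ a → map (a ∷_) (words k n)) (upTo k)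

wreath : ℕ → ℕ → List (List ℕ × List ℕ)
wreath k n = concatMap (λ σ → map (σ ,_) (words k n)) (perms n)

inv : List ℕ → ℕ
inv []       = 0
inv (x ∷ xs) = length (filter (_<? x) xs) N.+ inv xs

coinv : List ℕ → ℕ
coinv []       = 0
coinv (x ∷ xs) = length (filter (x <?_) xs) N.+ coinv xs

norm : List ℕ → ℕ
norm = sum

wrisStep : ℕ × ℕ → ℕ × ℕ → ℕ
wrisStep (s , a) (t , b) with s <? t | a N.≟ b
... | yes _ | yes _ = 1
... | _     | _     = 0

wrisL : List (ℕ × ℕ) → ℕ
wrisL []           = 0
wrisL (_ ∷ [])     = 0
wrisL (x ∷ y ∷ ys) = wrisStep x y N.+ wrisL (y ∷ ys)

wris : List ℕ × List ℕ → ℕ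
wris (σ , w) = wrisL (zip σ w)

-- Algebra in a commutative ring R (p, q, r elements of R; formal power
-- series in t are coefficient sequences ℕ → Carrier)

module WithRing {c ℓ : Level} (R : CommutativeRing c ℓ) where
  open CommutativeRing R

  pow : Carrier → ℕ → Carrier
  pow x zero    = 1#
  pow x (suc n) = x * pow x n

  sumR : List Carrier → Carrier
  sumR []       = 0#
  sumR (x ∷ xs) = x + sumR xs

  qint : Carrier → Carrier → ℕ → Carrier
  qint p q n = sumR (map (λ i → pow p (n ∸ suc i) * pow q i) (upTo n))

  qfact : Carrier → Carrier → ℕ → Carrier
  qfact p q zero    = 1#
  qfact p q (suc n) = qint p q (suc n) * qfact p q n

  kint : ℕ → Carrier → Carrier
  kint k x = sumR (map (pow x) (upTo k))

  wreathSum : ℕ → Carrier → Carrier → Carrier → ℕ → Carrier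
  wreathSum k p q r n =
    sumR (map (λ { (σ , w) → pow q (inv σ) * pow p (coinv σ) * pow r (norm w) })
              (filter (λ x → wris x N.≟ 0) (wreath k n)))

  conv : (ℕ → Carrier) → (ℕ → Carrier) → ℕ → Carrier
  conv f g n = sumR (map (λ j → f j * g (n ∸ j)) (upTo (suc n)))

  oneSeries : ℕ → Carrier
  oneSeries zero    = 1#
  oneSeries (suc n) = 0#

  -- LHS series: coefficient of tⁿ is  (1/[n]_{p,q}!) · wreathSum
  -- (ifac n is a given inverse of [n]_{p,q}!)
  lhsSeries : ℕ → Carrier → Carrier → Carrier → (ℕ → Carrier) → ℕ → Carrier
  lhsSeries k p q r ifac n = ifac n * wreathSum k p q r n

  denSeries : ℕ → Carrier → Carrier → Carrier → (ℕ → Carrier) → ℕ → Carrier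
  denSeries k p q r ifac zero    = 1#
  denSeries k p q r ifac (suc m) =
    pow p (suc m C 2) * pow (- 1#) (suc m) * ifac (suc m) * kint k (pow r (suc m))

module Submission where

-- Inclusion–exclusion over the leading run. For a coloured permutation, [wris = 0] equals
-- Σ_{i ≥ 0} (−1)^i [the first i+1 letters ascend in a single colour]·[the remaining letters have wris = 0].
-- Summed over colourings, a monochrome leading block of length m contributes [k]_{r^m}. Summed over
-- permutations, an increasing prefix of length m is the choice of its set of values followed by a free
-- permutation of the others; the (co)inversions across that split add up to p^(m choose 2) times the
-- (p,q)-binomial coefficient. Hence W(n+1) = Σ_i (−1)^i [k]_{r^(i+1)} p^((i+1) choose 2) [n+1 choose i+1]_{p,q} W(n−i)
-- for the wreath sums W, and dividing by [n+1]_{p,q}! says exactly that the (n+1)-st coefficient of the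
-- product with the denominator series vanishes.

open import Defs
open import Level using (Level)
open import Data.Nat using (ℕ; _≤_)
open import Algebra.Bundles using (CommutativeRing)

open import Algebra.Bundles using (CommutativeMonoid)
import Algebra.Properties.CommutativeSemigroup as CommutativeSemigroupProperties
open import Data.Bool using (Bool; true; false; _∧_; if_then_else_)
open import Data.Bool.Properties using (∧-zeroʳ; ∧-commutativeMonoid)
open import Data.List using (List; []; _∷_; [_]; _++_; length; filter; map; concatMap; applyDownFrom; applyUpTo; upTo; zip; drop)
import Data.List.Properties as LP
open import Data.List.Relation.Binary.Permutation.Propositional using (_↭_; ↭-refl; ↭-prep; ↭-swap; ↭-trans; ↭-sym)
open import Data.List.Relation.Binary.Permutation.Propositional.Properties using (↭-length; filter-↭; All-resp-↭; shift)
open import Data.List.Relation.Unary.All as All using (All; []; _∷_)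
import Data.List.Relation.Unary.All.Properties as All
open import Data.List.Relation.Unary.AllPairs using (AllPairs; []; _∷_)
import Data.Nat as N
open N using (zero; suc; _∸_; _<_; _>_; _<?_; _≟_; z≤n; s≤s)
open import Data.Nat.Combinatorics using (_C_; nCk+nC[k+1]≡[n+1]C[k+1]; nC1≡n)
open import Data.Nat.Induction using (<-rec)
open import Data.Nat.ListAction.Properties using (sum-++)
open import Data.Nat.Solver using (module +-*-Solver)
import Data.Nat.Properties as NP
open import Data.Product using (_×_; _,_; proj₁; proj₂)
open import Data.Sum using (inj₁; inj₂)
open import Function using (id)
open import Relation.Binary.PropositionalEquality using (_≡_; refl; sym; trans; cong; cong₂; subst)
import Relation.Binary.Reasoning.Setoid as SetoidReasoning
open import Relation.Nullary using (does; yes; no)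
open import Relation.Nullary.Decidable using (dec-true; dec-false)
open import Relation.Unary using (Pred; Decidable)

module ℕ+ = CommutativeSemigroupProperties NP.+-commutativeSemigroup
module 𝔹∧ = CommutativeSemigroupProperties (CommutativeMonoid.commutativeSemigroup ∧-commutativeMonoid)

+-exchange : ∀ b f {c d} → c ≡ f N.+ d → b N.+ c ≡ f N.+ (b N.+ d)
+-exchange b f eq = trans (cong (b N.+_) eq) (ℕ+.x∙yz≈y∙xz b f _)

-- Permutations, selections and chains

permutationsOf : List ℕ → List (List ℕ)
permutationsOf []       = [] ∷ []
permutationsOf (x ∷ xs) = concatMap (insertEverywhere x) (permutationsOf xs)

perms≡permutationsOf : ∀ n → perms n ≡ permutationsOf (applyDownFrom suc n)
perms≡permutationsOf zero    = refl
perms≡permutationsOf (suc n) = cong (concatMap (insertEverywhere (suc n))) (perms≡permutationsOf n)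

insertEverywhere-↭ : ∀ x xs → All (_↭ x ∷ xs) (insertEverywhere x xs)
insertEverywhere-↭ x []       = ↭-refl ∷ []
insertEverywhere-↭ x (y ∷ ys) =
  ↭-refl ∷ All.map⁺ (All.map (λ ρ↭ → ↭-trans (↭-prep y ρ↭) (↭-swap y x ↭-refl)) (insertEverywhere-↭ x ys))

permutationsOf-↭ : ∀ xs → All (_↭ xs) (permutationsOf xs)
permutationsOf-↭ []       = ↭-refl ∷ []
permutationsOf-↭ (x ∷ xs) = All.concat⁺ (All.map⁺ (All.map
  (λ {σ} σ↭ → All.map (λ ρ↭ → ↭-trans ρ↭ (↭-prep x σ↭)) (insertEverywhere-↭ x σ))
  (permutationsOf-↭ xs)))

Decreasing : List ℕ → Set
Decreasing = AllPairs _>_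

applyDownFrom-decreasing : ∀ n → Decreasing (applyDownFrom suc n)
applyDownFrom-decreasing zero    = []
applyDownFrom-decreasing (suc n) = All.applyDownFrom⁺₁ suc n s≤s ∷ applyDownFrom-decreasing n

insertAt : ℕ → ℕ → List ℕ → List ℕ
insertAt zero    x σ       = x ∷ σ
insertAt (suc m) x []      = x ∷ []
insertAt (suc m) x (c ∷ σ) = c ∷ insertAt m x σ

insertEverywhereFrom : ℕ → ℕ → List ℕ → List (List ℕ)
insertEverywhereFrom zero    x σ       = insertEverywhere x σ
insertEverywhereFrom (suc m) x []      = []
insertEverywhereFrom (suc m) x (c ∷ σ) = map (c ∷_) (insertEverywhereFrom m x σ)

insertAt-++ : ∀ A x τ → insertAt (length A) x (A ++ τ) ≡ A ++ x ∷ τ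
insertAt-++ []      x τ = refl
insertAt-++ (a ∷ A) x τ = cong (a ∷_) (insertAt-++ A x τ)

insertEverywhereFrom-++ : ∀ A x τ → insertEverywhereFrom (length A) x (A ++ τ) ≡ map (A ++_) (insertEverywhere x τ)
insertEverywhereFrom-++ []      x τ = sym (LP.map-id (insertEverywhere x τ))
insertEverywhereFrom-++ (a ∷ A) x τ =
  trans (cong (map (a ∷_)) (insertEverywhereFrom-++ A x τ)) (sym (LP.map-∘ (insertEverywhere x τ)))

-- Each way of picking m entries of xs, paired with the entries left over. The picked entries
-- come in reverse order, so they increase when xs decreases.
selections : List ℕ → ℕ → List (List ℕ × List ℕ)
selections xs       zero    = ([] , xs) ∷ []
selections []       (suc m) = []
selections (x ∷ xs) (suc m) =
  map (λ (A , B) → A , x ∷ B) (selections xs (suc m)) ++ map (λ (A , B) → A ++ [ x ] , B) (selections xs m)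

selections-length : ∀ xs m → All (λ (A , _) → length A ≡ m) (selections xs m)
selections-length xs       zero    = refl ∷ []
selections-length []       (suc m) = []
selections-length (x ∷ xs) (suc m) = All.++⁺
  (All.map⁺ (selections-length xs (suc m)))
  (All.map⁺ (All.map (λ {(A , _)} eq → trans (LP.length-++ A) (trans (NP.+-comm _ 1) (cong suc eq))) (selections-length xs m)))

selections-↭ : ∀ xs m → All (λ (A , B) → A ++ B ↭ xs) (selections xs m)
selections-↭ xs       zero    = ↭-refl ∷ []
selections-↭ []       (suc m) = []
selections-↭ (x ∷ xs) (suc m) = All.++⁺
  (All.map⁺ (All.map (λ {(A , B)} ↭xs → ↭-trans (shift x A B) (↭-prep x ↭xs)) (selections-↭ xs (suc m))))
  (All.map⁺ (All.map (λ {(A , B)} ↭xs → subst (_↭ x ∷ xs) (sym (LP.++-assoc A [ x ] B))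
                                          (↭-trans (shift x A B) (↭-prep x ↭xs))) (selections-↭ xs m)))

selections-decreasing : ∀ xs m → Decreasing xs → All (λ (_ , B) → Decreasing B) (selections xs m)
selections-decreasing xs       zero    dec         = dec ∷ []
selections-decreasing []       (suc m) dec         = []
selections-decreasing (x ∷ xs) (suc m) (x> ∷ dec) = All.++⁺
  (All.map⁺ (All.zipWith (λ {(A , B)} (B↓ , ↭xs) → All.++⁻ʳ A (All-resp-↭ (↭-sym ↭xs) x>) ∷ B↓)
                         (selections-decreasing xs (suc m) dec , selections-↭ xs (suc m))))
  (All.map⁺ (selections-decreasing xs m dec))

selections-bounded : ∀ {P : Pred ℕ Level.zero} xs m → All P xs → All (λ (A , B) → All P A × All P B) (selections xs m)
selections-bounded xs m Pxs = All.map (λ {(A , _)} ↭xs → All.++⁻ A (All-resp-↭ (↭-sym ↭xs) Pxs)) (selections-↭ xs m)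

selections-length-rest : ∀ xs m → All (λ (_ , B) → length B ≡ length xs ∸ m) (selections xs m)
selections-length-rest xs m = All.zipWith
  (λ {(A , B)} (∣A∣≡m , ↭xs) → trans (sym (NP.m+n∸m≡n (length A) (length B)))
                                     (cong₂ _∸_ (trans (sym (LP.length-++ A)) (↭-length ↭xs)) ∣A∣≡m))
  (selections-length xs m , selections-↭ xs m)

module _ {A : Set} (R : A → A → Bool) where

  linkedFrom : A → ℕ → List A → Bool
  linkedFrom a zero    _        = true
  linkedFrom a (suc m) []       = false
  linkedFrom a (suc m) (b ∷ xs) = R a b ∧ linkedFrom b m xs

  chainPrefix : ℕ → List A → Bool
  chainPrefix zero    _        = true
  chainPrefix (suc m) []       = false
  chainPrefix (suc m) (a ∷ xs) = linkedFrom a m xs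

_⊗_ : {A B : Set} → (A → A → Bool) → (B → B → Bool) → A × B → A × B → Bool
(R ⊗ S) (a , b) (a′ , b′) = R a a′ ∧ S b b′

module _ {A B : Set} (R : A → A → Bool) (S : B → B → Bool) where

  linkedFrom-zip : ∀ a b m xs ys →
    linkedFrom (R ⊗ S) (a , b) m (zip xs ys) ≡ linkedFrom R a m xs ∧ linkedFrom S b m ys
  linkedFrom-zip a b zero    xs       ys       = refl
  linkedFrom-zip a b (suc m) []       ys       = refl
  linkedFrom-zip a b (suc m) (x ∷ xs) []       = sym (∧-zeroʳ _)
  linkedFrom-zip a b (suc m) (x ∷ xs) (y ∷ ys) =
    trans (cong ((R a x ∧ S b y) ∧_) (linkedFrom-zip x y m xs ys))
          (𝔹∧.interchange (R a x) (S b y) (linkedFrom R x m xs) (linkedFrom S y m ys))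

  chainPrefix-zip : ∀ m xs ys →
    chainPrefix (R ⊗ S) m (zip xs ys) ≡ chainPrefix R m xs ∧ chainPrefix S m ys
  chainPrefix-zip zero    xs       ys       = refl
  chainPrefix-zip (suc m) []       ys       = refl
  chainPrefix-zip (suc m) (x ∷ xs) []       = sym (∧-zeroʳ _)
  chainPrefix-zip (suc m) (x ∷ xs) (y ∷ ys) = linkedFrom-zip x y m xs ys

module _ {A : Set} (R : A → A → Bool) where

  linkedFrom-++ : ∀ a u v → linkedFrom R a (length u) (u ++ v) ≡ linkedFrom R a (length u) u
  linkedFrom-++ a []      v = refl
  linkedFrom-++ a (b ∷ u) v = cong (R a b ∧_) (linkedFrom-++ b u v)

  chainPrefix-++ : ∀ u v → chainPrefix R (length u) (u ++ v) ≡ chainPrefix R (length u) u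
  chainPrefix-++ []      v = refl
  chainPrefix-++ (a ∷ u) v = linkedFrom-++ a u v

drop-++ : ∀ {A : Set} (u v : List A) → drop (length u) (u ++ v) ≡ v
drop-++ []      v = refl
drop-++ (a ∷ u) v = drop-++ u v

drop-zip : ∀ {A B : Set} m (xs : List A) (ys : List B) → drop m (zip xs ys) ≡ zip (drop m xs) (drop m ys)
drop-zip zero    xs       ys       = refl
drop-zip (suc m) []       ys       = refl
drop-zip (suc m) (x ∷ xs) []       = sym (LP.zipWith-zeroʳ _,_ (drop m xs))
drop-zip (suc m) (x ∷ xs) (y ∷ ys) = drop-zip m xs ys

length-zip : ∀ {A B : Set} {n} (xs : List A) (ys : List B) → length xs ≡ n → length ys ≡ n → length (zip xs ys) ≡ n
length-zip []       []       refl refl = refl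
length-zip (x ∷ xs) (y ∷ ys) refl eq   = cong suc (length-zip xs ys refl (NP.suc-injective eq))

increasing equal : ℕ → ℕ → Bool
increasing a b = does (a <? b)
equal      a b = does (a ≟ b)

wrisStep≡link : ∀ x y → wrisStep x y ≡ (if (increasing ⊗ equal) x y then 1 else 0)
wrisStep≡link (s , a) (t , b) with s <? t | a ≟ b
... | yes s<t | yes a≡b rewrite dec-true (s <? t) s<t | dec-true (a ≟ b) a≡b = refl
... | yes s<t | no  a≢b rewrite dec-true (s <? t) s<t | dec-false (a ≟ b) a≢b = refl
... | no  s≮t | _       rewrite dec-false (s <? t) s≮t = refl

-- Inversions and coinversions

length-filter-++ : ∀ {P : Pred ℕ Level.zero} (P? : Decidable P) xs ys →
  length (filter P? (xs ++ ys)) ≡ length (filter P? xs) N.+ length (filter P? ys)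
length-filter-++ P? xs ys = trans (cong length (LP.filter-++ P? xs ys)) (LP.length-++ (filter P? xs))

module PairCounts {R : ℕ → ℕ → Set} (R? : ∀ x → Decidable (R x)) where

  pairCount : List ℕ → ℕ
  pairCount []       = 0
  pairCount (x ∷ xs) = length (filter (R? x) xs) N.+ pairCount xs

  crossCount : List ℕ → List ℕ → ℕ
  crossCount []      B = 0
  crossCount (a ∷ A) B = length (filter (R? a) B) N.+ crossCount A B

  pairCount-++ : ∀ A B → pairCount (A ++ B) ≡ (pairCount A N.+ crossCount A B) N.+ pairCount B
  pairCount-++ []      B = refl
  pairCount-++ (a ∷ A) B = trans
    (cong₂ N._+_ (length-filter-++ (R? a) A B) (pairCount-++ A B))
    (+-rearrange (length (filter (R? a) A)) (length (filter (R? a) B)) (pairCount A) (crossCount A B) (pairCount B))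
    where
    open +-*-Solver
    +-rearrange : ∀ a b c d e → (a N.+ b) N.+ ((c N.+ d) N.+ e) ≡ ((a N.+ c) N.+ (b N.+ d)) N.+ e
    +-rearrange = solve 5 (λ a b c d e → (a :+ b) :+ ((c :+ d) :+ e) := ((a :+ c) :+ (b :+ d)) :+ e) refl

  crossCount-↭ : ∀ A {B B′} → B ↭ B′ → crossCount A B ≡ crossCount A B′
  crossCount-↭ []      B↭B′ = refl
  crossCount-↭ (a ∷ A) B↭B′ = cong₂ N._+_ (↭-length (filter-↭ (R? a) B↭B′)) (crossCount-↭ A B↭B′)

  pairCount-++-↭ : ∀ A {B τ} → τ ↭ B → pairCount (A ++ τ) ≡ (pairCount A N.+ crossCount A B) N.+ pairCount τ
  pairCount-++-↭ A {B} {τ} τ↭B =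
    trans (pairCount-++ A τ) (cong (λ c → (pairCount A N.+ c) N.+ pairCount τ) (crossCount-↭ A τ↭B))

  crossCount-++ˡ : ∀ A A′ B → crossCount (A ++ A′) B ≡ crossCount A B N.+ crossCount A′ B
  crossCount-++ˡ []      A′ B = refl
  crossCount-++ˡ (a ∷ A) A′ B =
    trans (cong (length (filter (R? a) B) N.+_) (crossCount-++ˡ A A′ B)) (sym (NP.+-assoc (length (filter (R? a) B)) _ _))

  crossCount-[] : ∀ A → crossCount A [] ≡ 0
  crossCount-[] []      = refl
  crossCount-[] (a ∷ A) = crossCount-[] A

  crossCount-∷ʳ : ∀ A x B → crossCount A (x ∷ B) ≡ length (filter (λ a → R? a x) A) N.+ crossCount A B
  crossCount-∷ʳ []      x B = refl
  crossCount-∷ʳ (a ∷ A) x B with does (R? a x)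
  ... | true  = cong suc (+-exchange (length (filter (R? a) B)) (length (filter (λ a → R? a x) A)) (crossCount-∷ʳ A x B))
  ... | false = +-exchange (length (filter (R? a) B)) (length (filter (λ a → R? a x) A)) (crossCount-∷ʳ A x B)

  pairCount+crossCount-∷ʳ : ∀ A x B → pairCount (A ++ [ x ]) N.+ crossCount (A ++ [ x ]) B
    ≡ (length (filter (λ a → R? a x) A) N.+ length (filter (R? x) B)) N.+ (pairCount A N.+ crossCount A B)
  pairCount+crossCount-∷ʳ A x B
    rewrite pairCount-++ A [ x ] | crossCount-++ˡ A [ x ] B | crossCount-∷ʳ A x [] | crossCount-[] A =
    rearrange (pairCount A) (length (filter (λ a → R? a x) A)) (crossCount A B) (length (filter (R? x) B))
    where
    open +-*-Solver
    rearrange : ∀ a f c g → ((a N.+ (f N.+ 0)) N.+ 0) N.+ (c N.+ (g N.+ 0)) ≡ (f N.+ g) N.+ (a N.+ c)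
    rearrange = solve 4 (λ a f c g → ((a :+ (f :+ con 0)) :+ con 0) :+ (c :+ (g :+ con 0)) := (f :+ g) :+ (a :+ c)) refl

length-filter-<-max : ∀ {x} A → All (_< x) A → length (filter (_<? x) A) ≡ length A
length-filter-<-max A A<x = cong length (LP.filter-all (_<? _) A<x)

length-filter->-max : ∀ {x} A → All (_< x) A → length (filter (x <?_) A) ≡ 0
length-filter->-max A A<x = cong length (LP.filter-none (_ <?_) (All.map NP.<⇒≯ A<x))

module Inversions = PairCounts (λ x → _<? x)
module Coinversions = PairCounts (λ x → x <?_)

inv≡pairCount : ∀ σ → inv σ ≡ Inversions.pairCount σ
inv≡pairCount []      = refl
inv≡pairCount (x ∷ σ) = cong (length (filter (_<? x) σ) N.+_) (inv≡pairCount σ)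

coinv≡pairCount : ∀ σ → coinv σ ≡ Coinversions.pairCount σ
coinv≡pairCount []      = refl
coinv≡pairCount (x ∷ σ) = cong (length (filter (x <?_) σ) N.+_) (coinv≡pairCount σ)

-- Finite sums in a commutative ring

module _ {c ℓ : Level} (R : CommutativeRing c ℓ) where
  open CommutativeRing R renaming (refl to ≈-refl; sym to ≈-sym; trans to ≈-trans)
  open WithRing R
  open import Algebra.Properties.Ring ring using (-0#≈0#; -1*x≈-x)
  open import Algebra.Solver.Ring.NaturalCoefficients.Default commutativeSemiring using (solve; _:=_; _:+_; _:*_)
  open SetoidReasoning setoid
  module +ᶜ = CommutativeSemigroupProperties +-commutativeSemigroup
  module *ᶜ = CommutativeSemigroupProperties *-commutativeSemigroup

  private variable
    a b : Level
    A : Set a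
    B : Set b

  ∑ : List A → (A → Carrier) → Carrier
  ∑ xs f = sumR (map f xs)
  syntax ∑ xs (λ x → e) = ∑[ x ∈ xs ] e

  ∑-cong : ∀ (xs : List A) {f g} → (∀ x → f x ≈ g x) → ∑ xs f ≈ ∑ xs g
  ∑-cong []       f≈g = ≈-refl
  ∑-cong (x ∷ xs) f≈g = +-cong (f≈g x) (∑-cong xs f≈g)

  ∑-cong-All : ∀ {p} {P : A → Set p} {xs : List A} {f g} → All P xs → (∀ {x} → P x → f x ≈ g x) → ∑ xs f ≈ ∑ xs g
  ∑-cong-All []         f≈g = ≈-refl
  ∑-cong-All (px ∷ pxs) f≈g = +-cong (f≈g px) (∑-cong-All pxs f≈g)

  ∑-++ : ∀ (xs ys : List A) f → ∑ (xs ++ ys) f ≈ ∑ xs f + ∑ ys f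
  ∑-++ []       ys f = ≈-sym (+-identityˡ _)
  ∑-++ (x ∷ xs) ys f = ≈-trans (+-congˡ (∑-++ xs ys f)) (≈-sym (+-assoc _ _ _))

  ∑-zero : ∀ (xs : List A) {f} → (∀ x → f x ≈ 0#) → ∑ xs f ≈ 0#
  ∑-zero []       f≈0 = ≈-refl
  ∑-zero (x ∷ xs) f≈0 = ≈-trans (+-cong (f≈0 x) (∑-zero xs f≈0)) (+-identityˡ 0#)

  ∑-+ : ∀ (xs : List A) f g → ∑[ x ∈ xs ] (f x + g x) ≈ ∑ xs f + ∑ xs g
  ∑-+ []       f g = ≈-sym (+-identityˡ 0#)
  ∑-+ (x ∷ xs) f g = ≈-trans (+-congˡ (∑-+ xs f g)) (+ᶜ.interchange (f x) (g x) _ _)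

  *-distribˡ-∑ : ∀ k (xs : List A) f → k * ∑ xs f ≈ ∑[ x ∈ xs ] (k * f x)
  *-distribˡ-∑ k []       f = zeroʳ k
  *-distribˡ-∑ k (x ∷ xs) f = ≈-trans (distribˡ k _ _) (+-congˡ (*-distribˡ-∑ k xs f))

  *-distribʳ-∑ : ∀ k (xs : List A) f → ∑ xs f * k ≈ ∑[ x ∈ xs ] (f x * k)
  *-distribʳ-∑ k xs f = ≈-trans (*-comm _ k) (≈-trans (*-distribˡ-∑ k xs f) (∑-cong xs (λ x → *-comm k (f x))))

  ∑-map : ∀ (h : A → B) xs f → ∑ (map h xs) f ≈ ∑[ x ∈ xs ] f (h x)
  ∑-map h []       f = ≈-refl
  ∑-map h (x ∷ xs) f = +-congˡ (∑-map h xs f)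

  ∑-concatMap : ∀ (h : A → List B) xs f → ∑ (concatMap h xs) f ≈ ∑[ x ∈ xs ] ∑ (h x) f
  ∑-concatMap h []       f = ≈-refl
  ∑-concatMap h (x ∷ xs) f = ≈-trans (∑-++ (h x) (concatMap h xs) f) (+-congˡ (∑-concatMap h xs f))

  𝟙 : Bool → Carrier
  𝟙 true  = 1#
  𝟙 false = 0#

  𝟙-∧ : ∀ a b → 𝟙 (a ∧ b) ≈ 𝟙 a * 𝟙 b
  𝟙-∧ true  b = ≈-sym (*-identityˡ _)
  𝟙-∧ false b = ≈-sym (zeroˡ _)

  private
    0*-+ : ∀ x y → 0# * x + y ≈ y
    0*-+ x y = ≈-trans (+-congʳ (zeroˡ x)) (+-identityˡ y)

    0*-+-0* : ∀ x y → 0# * x + 0# ≈ 0# * y + 0# * 0#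
    0*-+-0* x y = ≈-trans (0*-+ x 0#) (≈-sym (≈-trans (0*-+ y _) (zeroˡ 0#)))

  ∑-filter : ∀ {P : A → Set b} (P? : Decidable P) xs f → ∑ (filter P? xs) f ≈ ∑[ x ∈ xs ] (𝟙 (does (P? x)) * f x)
  ∑-filter P? []       f = ≈-refl
  ∑-filter P? (x ∷ xs) f with does (P? x)
  ... | true  = +-cong (≈-sym (*-identityˡ _)) (∑-filter P? xs f)
  ... | false = ≈-trans (∑-filter P? xs f) (≈-sym (0*-+ _ _))

  ∑< : ℕ → (ℕ → Carrier) → Carrier
  ∑< zero    f = 0#
  ∑< (suc n) f = f 0 + ∑< n (λ i → f (suc i))
  syntax ∑< n (λ i → e) = ∑[ i < n ] e

  ∑<-cong : ∀ n {f g} → (∀ i → i < n → f i ≈ g i) → ∑< n f ≈ ∑< n g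
  ∑<-cong zero    f≈g = ≈-refl
  ∑<-cong (suc n) f≈g = +-cong (f≈g 0 (s≤s z≤n)) (∑<-cong n (λ i i<n → f≈g (suc i) (s≤s i<n)))

  ∑<-zero : ∀ n {f} → (∀ i → i < n → f i ≈ 0#) → ∑< n f ≈ 0#
  ∑<-zero zero    f≈0 = ≈-refl
  ∑<-zero (suc n) f≈0 = ≈-trans (+-cong (f≈0 0 (s≤s z≤n)) (∑<-zero n (λ i i<n → f≈0 (suc i) (s≤s i<n)))) (+-identityˡ 0#)

  ∑<-+ : ∀ n f g → ∑[ i < n ] (f i + g i) ≈ ∑< n f + ∑< n g
  ∑<-+ zero    f g = ≈-sym (+-identityˡ 0#)
  ∑<-+ (suc n) f g = ≈-trans (+-congˡ (∑<-+ n (λ i → f (suc i)) (λ i → g (suc i)))) (+ᶜ.interchange (f 0) (g 0) _ _)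

  *-distribˡ-∑< : ∀ k n f → k * ∑< n f ≈ ∑[ i < n ] (k * f i)
  *-distribˡ-∑< k zero    f = zeroʳ k
  *-distribˡ-∑< k (suc n) f = ≈-trans (distribˡ k _ _) (+-congˡ (*-distribˡ-∑< k n _))

  ∑<-last : ∀ n f → ∑< (suc n) f ≈ ∑< n f + f n
  ∑<-last zero    f = ≈-trans (+-identityʳ _) (≈-sym (+-identityˡ _))
  ∑<-last (suc n) f = ≈-trans (+-congˡ (∑<-last n (λ i → f (suc i)))) (≈-sym (+-assoc _ _ _))

  ∑<-reverse : ∀ n f → ∑< n f ≈ ∑[ i < n ] f (n ∸ suc i)
  ∑<-reverse zero    f = ≈-refl
  ∑<-reverse (suc n) f = ≈-trans (∑<-last n f) (≈-trans (+-comm _ _) (+-congˡ (∑<-reverse n f)))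

  ∑-∑< : ∀ (xs : List A) n (f : A → ℕ → Carrier) → ∑[ x ∈ xs ] ∑< n (f x) ≈ ∑[ i < n ] ∑[ x ∈ xs ] f x i
  ∑-∑< xs zero    f = ∑-zero xs (λ _ → ≈-refl)
  ∑-∑< xs (suc n) f = ≈-trans (∑-+ xs (λ x → f x 0) _) (+-congˡ (∑-∑< xs n (λ x i → f x (suc i))))

  ∑<≈∑-upTo : ∀ n f → ∑< n f ≈ ∑ (upTo n) f
  ∑<≈∑-upTo n f = go n id
    where
    go : ∀ n g → ∑[ i < n ] f (g i) ≈ ∑ (applyUpTo g n) f
    go zero    g = ≈-refl
    go (suc n) g = +-congˡ (go n (λ i → g (suc i)))

  ∑<-δ : ∀ {a k} → a < k → (h : ℕ → Carrier) → ∑[ b < k ] (𝟙 (equal a b) * h b) ≈ h a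
  ∑<-δ {zero}  {suc k} _          h =
    ≈-trans (+-cong (*-identityˡ _) (∑<-zero k (λ _ _ → zeroˡ _))) (+-identityʳ _)
  ∑<-δ {suc a} {suc k} (s≤s a<k) h = ≈-trans (0*-+ _ _) (∑<-δ a<k (λ b → h (suc b)))

  pow-+ : ∀ x a b → pow x (a N.+ b) ≈ pow x a * pow x b
  pow-+ x zero    b = ≈-sym (*-identityˡ _)
  pow-+ x (suc a) b = ≈-trans (*-congˡ (pow-+ x a b)) (≈-sym (*-assoc _ _ _))

  pow-pow : ∀ x n a → pow (pow x n) a ≈ pow x (n N.* a)
  pow-pow x n zero    = reflexive (cong (pow x) (sym (NP.*-zeroʳ n)))
  pow-pow x n (suc a) = ≈-trans (*-congˡ (pow-pow x n a))
    (≈-trans (≈-sym (pow-+ x n (n N.* a))) (reflexive (cong (pow x) (sym (NP.*-suc n a)))))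

  -- Permutations with an increasing prefix

  ∑-insertEverywhere-linkedFrom : ∀ b x m σ (G : List ℕ → Carrier) → b < x → All (_< x) σ →
    ∑[ ρ ∈ insertEverywhere x σ ] (𝟙 (linkedFrom increasing b (suc m) ρ) * G ρ)
      ≈ 𝟙 (linkedFrom increasing b m σ) * G (insertAt m x σ)
        + 𝟙 (linkedFrom increasing b (suc m) σ) * ∑ (insertEverywhereFrom (suc m) x σ) G
  ∑-insertEverywhere-linkedFrom b x zero [] G b<x [] rewrite dec-true (b <? x) b<x = +-congˡ (≈-sym (zeroˡ 0#))
  ∑-insertEverywhere-linkedFrom b x (suc m) [] G b<x [] rewrite dec-true (b <? x) b<x = 0*-+-0* _ _
  ∑-insertEverywhere-linkedFrom b x zero (c ∷ σ) G b<x (c<x ∷ σ<x) rewrite dec-true (b <? x) b<x = +-congˡ (begin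
    ∑ (map (c ∷_) (insertEverywhere x σ)) (λ ρ → 𝟙 (linkedFrom increasing b 1 ρ) * G ρ) ≈⟨ ∑-map (c ∷_) (insertEverywhere x σ) _ ⟩
    ∑[ ρ ∈ insertEverywhere x σ ] (𝟙 (increasing b c ∧ true) * G (c ∷ ρ))              ≈⟨ *-distribˡ-∑ _ (insertEverywhere x σ) _ ⟨
    𝟙 (increasing b c ∧ true) * ∑[ ρ ∈ insertEverywhere x σ ] G (c ∷ ρ)                ≈⟨ *-congˡ (∑-map (c ∷_) (insertEverywhere x σ) G) ⟨
    𝟙 (increasing b c ∧ true) * ∑ (map (c ∷_) (insertEverywhere x σ)) G                ∎)
  ∑-insertEverywhere-linkedFrom b x (suc m) (c ∷ σ) G b<x (c<x ∷ σ<x)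
    rewrite dec-true (b <? x) b<x | dec-false (x <? c) (NP.<⇒≯ c<x) = ≈-trans (0*-+ _ _) (begin
    ∑ (map (c ∷_) (insertEverywhere x σ)) (λ ρ → 𝟙 (linkedFrom increasing b (suc (suc m)) ρ) * G ρ)
      ≈⟨ ∑-map (c ∷_) (insertEverywhere x σ) _ ⟩
    ∑[ ρ ∈ insertEverywhere x σ ] (𝟙 (bc ∧ linkedFrom increasing c (suc m) ρ) * G (c ∷ ρ))
      ≈⟨ ∑-cong (insertEverywhere x σ) (λ ρ → ≈-trans (*-congʳ (𝟙-∧ bc _)) (*-assoc _ _ _)) ⟩
    ∑[ ρ ∈ insertEverywhere x σ ] (𝟙 bc * (𝟙 (linkedFrom increasing c (suc m) ρ) * G (c ∷ ρ)))
      ≈⟨ *-distribˡ-∑ (𝟙 bc) (insertEverywhere x σ) _ ⟨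
    𝟙 bc * ∑[ ρ ∈ insertEverywhere x σ ] (𝟙 (linkedFrom increasing c (suc m) ρ) * G (c ∷ ρ))
      ≈⟨ *-congˡ (∑-insertEverywhere-linkedFrom c x m σ (λ ρ → G (c ∷ ρ)) c<x σ<x) ⟩
    𝟙 bc * (𝟙 (linkedFrom increasing c m σ) * G (c ∷ insertAt m x σ)
             + 𝟙 (linkedFrom increasing c (suc m) σ) * ∑[ ρ ∈ insertEverywhereFrom (suc m) x σ ] G (c ∷ ρ))
      ≈⟨ distribˡ (𝟙 bc) _ _ ⟩
    𝟙 bc * (𝟙 (linkedFrom increasing c m σ) * G (c ∷ insertAt m x σ))
      + 𝟙 bc * (𝟙 (linkedFrom increasing c (suc m) σ) * ∑[ ρ ∈ insertEverywhereFrom (suc m) x σ ] G (c ∷ ρ))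
      ≈⟨ +-cong (≈-trans (≈-sym (*-assoc _ _ _)) (*-congʳ (≈-sym (𝟙-∧ bc _))))
                (≈-trans (≈-sym (*-assoc _ _ _)) (*-cong (≈-sym (𝟙-∧ bc _))
                                                        (≈-sym (∑-map (c ∷_) (insertEverywhereFrom (suc m) x σ) G)))) ⟩
    𝟙 (bc ∧ linkedFrom increasing c m σ) * G (c ∷ insertAt m x σ)
      + 𝟙 (bc ∧ linkedFrom increasing c (suc m) σ) * ∑ (map (c ∷_) (insertEverywhereFrom (suc m) x σ)) G ∎)
    where bc = increasing b c

  ∑-insertEverywhere-chainPrefix : ∀ x m σ (G : List ℕ → Carrier) → All (_< x) σ →
    ∑[ ρ ∈ insertEverywhere x σ ] (𝟙 (chainPrefix increasing (suc m) ρ) * G ρ)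
      ≈ 𝟙 (chainPrefix increasing m σ) * G (insertAt m x σ)
        + 𝟙 (chainPrefix increasing (suc m) σ) * ∑ (insertEverywhereFrom (suc m) x σ) G
  ∑-insertEverywhere-chainPrefix x zero    []      G [] = +-congˡ (≈-sym (zeroˡ 0#))
  ∑-insertEverywhere-chainPrefix x (suc m) []      G [] = 0*-+-0* _ _
  ∑-insertEverywhere-chainPrefix x zero    (a ∷ σ) G (a<x ∷ σ<x) = +-congˡ (begin
    ∑ (map (a ∷_) (insertEverywhere x σ)) (λ ρ → 𝟙 (chainPrefix increasing 1 ρ) * G ρ) ≈⟨ ∑-map (a ∷_) (insertEverywhere x σ) _ ⟩
    ∑[ ρ ∈ insertEverywhere x σ ] (1# * G (a ∷ ρ))                                      ≈⟨ *-distribˡ-∑ 1# (insertEverywhere x σ) _ ⟨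
    1# * ∑[ ρ ∈ insertEverywhere x σ ] G (a ∷ ρ)                                        ≈⟨ *-congˡ (∑-map (a ∷_) (insertEverywhere x σ) G) ⟨
    1# * ∑ (map (a ∷_) (insertEverywhere x σ)) G                                        ∎)
  ∑-insertEverywhere-chainPrefix x (suc m) (a ∷ σ) G (a<x ∷ σ<x)
    rewrite dec-false (x <? a) (NP.<⇒≯ a<x) = ≈-trans (0*-+ _ _) (begin
    ∑ (map (a ∷_) (insertEverywhere x σ)) (λ ρ → 𝟙 (chainPrefix increasing (suc (suc m)) ρ) * G ρ)
      ≈⟨ ∑-map (a ∷_) (insertEverywhere x σ) _ ⟩
    ∑[ ρ ∈ insertEverywhere x σ ] (𝟙 (linkedFrom increasing a (suc m) ρ) * G (a ∷ ρ))
      ≈⟨ ∑-insertEverywhere-linkedFrom a x m σ (λ ρ → G (a ∷ ρ)) a<x σ<x ⟩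
    𝟙 (linkedFrom increasing a m σ) * G (a ∷ insertAt m x σ)
      + 𝟙 (linkedFrom increasing a (suc m) σ) * ∑[ ρ ∈ insertEverywhereFrom (suc m) x σ ] G (a ∷ ρ)
      ≈⟨ +-congˡ (*-congˡ (∑-map (a ∷_) (insertEverywhereFrom (suc m) x σ) G)) ⟨
    𝟙 (linkedFrom increasing a m σ) * G (a ∷ insertAt m x σ)
      + 𝟙 (linkedFrom increasing a (suc m) σ) * ∑ (map (a ∷_) (insertEverywhereFrom (suc m) x σ)) G ∎)

  ∑-selections-∷ : ∀ x xs m (F : List ℕ × List ℕ → Carrier) → ∑ (selections (x ∷ xs) (suc m)) F
    ≈ ∑[ AB ∈ selections xs (suc m) ] F (proj₁ AB , x ∷ proj₂ AB) + ∑[ AB ∈ selections xs m ] F (proj₁ AB ++ [ x ] , proj₂ AB)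
  ∑-selections-∷ x xs m F = ≈-trans (∑-++ (map _ (selections xs (suc m))) (map _ (selections xs m)) F)
                                    (+-cong (∑-map _ (selections xs (suc m)) F) (∑-map _ (selections xs m) F))

  prefixedSum : (List ℕ → Carrier) → List ℕ × List ℕ → Carrier
  prefixedSum G (A , B) = ∑[ τ ∈ permutationsOf B ] G (A ++ τ)

  -- Inserting the maximum x of ds keeps an increasing prefix of length m+1 exactly when
  -- it lands at position m behind an increasing m-prefix, or further right behind an increasing (m+1)-prefix.
  ∑-permutationsOf-increasingPrefix : ∀ ds → Decreasing ds → ∀ m (G : List ℕ → Carrier) →
    ∑[ σ ∈ permutationsOf ds ] (𝟙 (chainPrefix increasing m σ) * G σ) ≈ ∑ (selections ds m) (prefixedSum G)
  ∑-permutationsOf-increasingPrefix ds       dec        zero    G =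
    ≈-trans (∑-cong (permutationsOf ds) (λ σ → *-identityˡ (G σ))) (≈-sym (+-identityʳ _))
  ∑-permutationsOf-increasingPrefix []       dec        (suc m) G = ≈-trans (+-identityʳ _) (zeroˡ _)
  ∑-permutationsOf-increasingPrefix (x ∷ xs) (x> ∷ dec) (suc m) G = begin
    ∑ (concatMap (insertEverywhere x) (permutationsOf xs)) (λ ρ → 𝟙 (chainPrefix increasing (suc m) ρ) * G ρ)
      ≈⟨ ∑-concatMap (insertEverywhere x) (permutationsOf xs) _ ⟩
    ∑[ σ ∈ permutationsOf xs ] ∑[ ρ ∈ insertEverywhere x σ ] (𝟙 (chainPrefix increasing (suc m) ρ) * G ρ)
      ≈⟨ ∑-cong-All (permutationsOf-↭ xs) (λ {σ} σ↭ → ∑-insertEverywhere-chainPrefix x m σ G (All-resp-↭ (↭-sym σ↭) x>)) ⟩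
    ∑[ σ ∈ permutationsOf xs ] (𝟙 (chainPrefix increasing m σ) * G₁ σ + 𝟙 (chainPrefix increasing (suc m) σ) * G₂ σ)
      ≈⟨ ∑-+ (permutationsOf xs) _ _ ⟩
    ∑[ σ ∈ permutationsOf xs ] (𝟙 (chainPrefix increasing m σ) * G₁ σ)
      + ∑[ σ ∈ permutationsOf xs ] (𝟙 (chainPrefix increasing (suc m) σ) * G₂ σ)
      ≈⟨ +-cong (∑-permutationsOf-increasingPrefix xs dec m G₁) (∑-permutationsOf-increasingPrefix xs dec (suc m) G₂) ⟩
    ∑ (selections xs m) (prefixedSum G₁) + ∑ (selections xs (suc m)) (prefixedSum G₂)
      ≈⟨ +-comm _ _ ⟩
    ∑ (selections xs (suc m)) (prefixedSum G₂) + ∑ (selections xs m) (prefixedSum G₁)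
      ≈⟨ +-cong (∑-cong-All (selections-length xs (suc m)) λ {(A , B)} → x-unpicked {A} {B})
                (∑-cong-All (selections-length xs m) λ {(A , B)} → x-picked {A} {B}) ⟨
    ∑[ AB ∈ selections xs (suc m) ] prefixedSum G (proj₁ AB , x ∷ proj₂ AB)
      + ∑[ AB ∈ selections xs m ] prefixedSum G (proj₁ AB ++ [ x ] , proj₂ AB)
      ≈⟨ ∑-selections-∷ x xs m (prefixedSum G) ⟨
    ∑ (selections (x ∷ xs) (suc m)) (prefixedSum G) ∎
    where
    G₁ G₂ : List ℕ → Carrier
    G₁ σ = G (insertAt m x σ)
    G₂ σ = ∑ (insertEverywhereFrom (suc m) x σ) G

    x-unpicked : ∀ {A B} → length A ≡ suc m → prefixedSum G (A , x ∷ B) ≈ prefixedSum G₂ (A , B)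
    x-unpicked {A} {B} ∣A∣≡ = ≈-trans (∑-concatMap (insertEverywhere x) (permutationsOf B) _) (∑-cong (permutationsOf B) λ τ →
      ≈-sym (≈-trans (reflexive (cong (λ ρs → ∑ ρs G)
                        (trans (cong (λ j → insertEverywhereFrom j x (A ++ τ)) (sym ∣A∣≡)) (insertEverywhereFrom-++ A x τ))))
                     (∑-map (A ++_) (insertEverywhere x τ) G)))

    x-picked : ∀ {A B} → length A ≡ m → prefixedSum G (A ++ [ x ] , B) ≈ prefixedSum G₁ (A , B)
    x-picked {A} {B} ∣A∣≡ = ∑-cong (permutationsOf B) λ τ → reflexive (cong G
      (trans (LP.++-assoc A [ x ] τ) (sym (trans (cong (λ j → insertAt j x (A ++ τ)) (sym ∣A∣≡)) (insertAt-++ A x τ)))))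

  -- Inclusion–exclusion over the leading run, and colourings

  wrisFree : List (ℕ × ℕ) → Carrier
  wrisFree L = 𝟙 (does (wrisL L ≟ 0))

  sgn : ℕ → Carrier
  sgn = pow (- 1#)

  wrisFree-∷∷ : ∀ x y L → wrisFree (x ∷ y ∷ L) ≈ wrisFree (y ∷ L) - 𝟙 ((increasing ⊗ equal) x y) * wrisFree (y ∷ L)
  wrisFree-∷∷ x y L rewrite wrisStep≡link x y with (increasing ⊗ equal) x y
  ... | true  = ≈-sym (≈-trans (+-congˡ (-‿cong (*-identityˡ _))) (-‿inverseʳ _))
  ... | false = ≈-sym (≈-trans (+-congˡ (≈-trans (-‿cong (zeroˡ _)) -0#≈0#)) (+-identityʳ _))

  wrisFree-inclusionExclusion : ∀ {n} L → length L ≡ suc n →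
    wrisFree L ≈ ∑[ i < suc n ] (sgn i * (𝟙 (chainPrefix (increasing ⊗ equal) (suc i) L) * wrisFree (drop (suc i) L)))
  wrisFree-inclusionExclusion (x ∷ [])    refl = ≈-sym (≈-trans (+-identityʳ _) (≈-trans (*-identityˡ _) (*-identityˡ _)))
  wrisFree-inclusionExclusion (x ∷ y ∷ L) refl = begin
    wrisFree (x ∷ y ∷ L)
      ≈⟨ wrisFree-∷∷ x y L ⟩
    wrisFree (y ∷ L) - 𝟙 xy * wrisFree (y ∷ L)
      ≈⟨ +-cong (≈-sym (≈-trans (*-identityˡ _) (*-identityˡ _))) (-‿cong (*-congˡ (wrisFree-inclusionExclusion (y ∷ L) refl))) ⟩
    sgn 0 * (1# * wrisFree (y ∷ L)) - 𝟙 xy * ∑< (suc (length L)) term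
      ≈⟨ +-congˡ (≈-sym (-1*x≈-x _)) ⟩
    sgn 0 * (1# * wrisFree (y ∷ L)) + - 1# * (𝟙 xy * ∑< (suc (length L)) term)
      ≈⟨ +-congˡ (*-congˡ (*-distribˡ-∑< (𝟙 xy) (suc (length L)) term)) ⟩
    sgn 0 * (1# * wrisFree (y ∷ L)) + - 1# * ∑[ i < suc (length L) ] (𝟙 xy * term i)
      ≈⟨ +-congˡ (*-distribˡ-∑< (- 1#) (suc (length L)) (λ i → 𝟙 xy * term i)) ⟩
    sgn 0 * (1# * wrisFree (y ∷ L)) + ∑[ i < suc (length L) ] (- 1# * (𝟙 xy * term i))
      ≈⟨ +-congˡ (∑<-cong (suc (length L)) λ i _ →
           ≈-trans (rearrange (- 1#) (𝟙 xy) (sgn i) (𝟙 (yLinked i)) (wrisFree (drop i L)))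
                   (*-congˡ (*-congʳ (≈-sym (𝟙-∧ xy (yLinked i)))))) ⟩
    sgn 0 * (1# * wrisFree (y ∷ L))
      + ∑[ i < suc (length L) ] (sgn (suc i) * (𝟙 (xy ∧ yLinked i) * wrisFree (drop i L))) ∎
    where
    xy = (increasing ⊗ equal) x y
    yLinked : ℕ → Bool
    yLinked i = linkedFrom (increasing ⊗ equal) y i L
    term : ℕ → Carrier
    term i = sgn i * (𝟙 (yLinked i) * wrisFree (drop i L))
    rearrange : ∀ m l s c w → m * (l * (s * (c * w))) ≈ (m * s) * ((l * c) * w)
    rearrange = solve 5 (λ m l s c w → m :* (l :* (s :* (c :* w))) := (m :* s) :* ((l :* c) :* w)) ≈-refl

  words-length : ∀ k n → All (λ w → length w ≡ n) (words k n)
  words-length k zero    = refl ∷ []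
  words-length k (suc n) =
    All.concat⁺ (All.map⁺ (All.applyUpTo⁺₂ id k (λ _ → All.map⁺ (All.map (cong suc) (words-length k n)))))

  ∑-words-suc : ∀ k m (F : List ℕ → Carrier) → ∑ (words k (suc m)) F ≈ ∑[ b ∈ upTo k ] ∑[ u ∈ words k m ] F (b ∷ u)
  ∑-words-suc k m F = ≈-trans (∑-concatMap (λ b → map (b ∷_) (words k m)) (upTo k) F)
                              (∑-cong (upTo k) λ b → ∑-map (b ∷_) (words k m) F)

  ∑-words-+ : ∀ k m j (F : List ℕ → Carrier) →
    ∑ (words k (m N.+ j)) F ≈ ∑[ u ∈ words k m ] ∑[ v ∈ words k j ] F (u ++ v)
  ∑-words-+ k zero    j F = ≈-sym (+-identityʳ _)
  ∑-words-+ k (suc m) j F = begin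
    ∑ (words k (suc m N.+ j)) F                                         ≈⟨ ∑-words-suc k (m N.+ j) F ⟩
    ∑[ b ∈ upTo k ] ∑[ w ∈ words k (m N.+ j) ] F (b ∷ w)                ≈⟨ ∑-cong (upTo k) (λ b → ∑-words-+ k m j (λ w → F (b ∷ w))) ⟩
    ∑[ b ∈ upTo k ] ∑[ u ∈ words k m ] ∑[ v ∈ words k j ] F (b ∷ u ++ v) ≈⟨ ∑-words-suc k m _ ⟨
    ∑[ u ∈ words k (suc m) ] ∑[ v ∈ words k j ] F (u ++ v)               ∎

  private
    weigh-first-letter : ∀ r b u c d → pow r (norm (b ∷ u)) * 𝟙 (c ∧ d) ≈ 𝟙 c * (pow r b * (pow r (norm u) * 𝟙 d))
    weigh-first-letter r b u c d = ≈-trans (*-cong (pow-+ r b (norm u)) (𝟙-∧ c d)) (shuffle _ _ _ _)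
      where
      shuffle : ∀ x y z w → (x * y) * (z * w) ≈ z * (x * (y * w))
      shuffle = solve 4 (λ x y z w → (x :* y) :* (z :* w) := z :* (x :* (y :* w))) ≈-refl

  ∑-words-monochromeFrom : ∀ k r m {a} → a < k →
    ∑[ u ∈ words k m ] (pow r (norm u) * 𝟙 (linkedFrom equal a m u)) ≈ pow r (m N.* a)
  ∑-words-monochromeFrom k r zero    a<k = ≈-trans (+-identityʳ _) (*-identityʳ _)
  ∑-words-monochromeFrom k r (suc m) {a} a<k = begin
    ∑[ u ∈ words k (suc m) ] (pow r (norm u) * 𝟙 (linkedFrom equal a (suc m) u))
      ≈⟨ ∑-words-suc k m _ ⟩
    ∑[ b ∈ upTo k ] ∑[ u ∈ words k m ] (pow r (norm (b ∷ u)) * 𝟙 (equal a b ∧ linkedFrom equal b m u))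
      ≈⟨ ∑-cong (upTo k) (λ b → ∑-cong (words k m) λ u → weigh-first-letter r b u (equal a b) (linkedFrom equal b m u)) ⟩
    ∑[ b ∈ upTo k ] ∑[ u ∈ words k m ] (𝟙 (equal a b) * (pow r b * (pow r (norm u) * 𝟙 (linkedFrom equal b m u))))
      ≈⟨ ∑-cong (upTo k) (λ b → ≈-trans (≈-sym (*-distribˡ-∑ _ (words k m) _)) (*-congˡ (≈-sym (*-distribˡ-∑ _ (words k m) _)))) ⟩
    ∑[ b ∈ upTo k ] (𝟙 (equal a b) * (pow r b * ∑[ u ∈ words k m ] (pow r (norm u) * 𝟙 (linkedFrom equal b m u))))
      ≈⟨ ∑-cong-All (All.applyUpTo⁺₁ id k id) (λ b<k → *-congˡ (*-congˡ (∑-words-monochromeFrom k r m b<k))) ⟩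
    ∑[ b ∈ upTo k ] (𝟙 (equal a b) * (pow r b * pow r (m N.* b)))
      ≈⟨ ∑<≈∑-upTo k _ ⟨
    ∑[ b < k ] (𝟙 (equal a b) * (pow r b * pow r (m N.* b)))
      ≈⟨ ∑<-δ a<k (λ b → pow r b * pow r (m N.* b)) ⟩
    pow r a * pow r (m N.* a)
      ≈⟨ pow-+ r a (m N.* a) ⟨
    pow r (suc m N.* a) ∎

  ∑-words-monochrome : ∀ k r m →
    ∑[ u ∈ words k (suc m) ] (pow r (norm u) * 𝟙 (chainPrefix equal (suc m) u)) ≈ kint k (pow r (suc m))
  ∑-words-monochrome k r m = begin
    ∑[ u ∈ words k (suc m) ] (pow r (norm u) * 𝟙 (chainPrefix equal (suc m) u))
      ≈⟨ ∑-words-suc k m _ ⟩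
    ∑[ b ∈ upTo k ] ∑[ u ∈ words k m ] (pow r (norm (b ∷ u)) * 𝟙 (true ∧ linkedFrom equal b m u))
      ≈⟨ ∑-cong (upTo k) (λ b → ∑-cong (words k m) λ u → ≈-trans (weigh-first-letter r b u true (linkedFrom equal b m u)) (*-identityˡ _)) ⟩
    ∑[ b ∈ upTo k ] ∑[ u ∈ words k m ] (pow r b * (pow r (norm u) * 𝟙 (linkedFrom equal b m u)))
      ≈⟨ ∑-cong (upTo k) (λ b → ≈-sym (*-distribˡ-∑ _ (words k m) _)) ⟩
    ∑[ b ∈ upTo k ] (pow r b * ∑[ u ∈ words k m ] (pow r (norm u) * 𝟙 (linkedFrom equal b m u)))
      ≈⟨ ∑-cong-All (All.applyUpTo⁺₁ id k id) (λ b<k → *-congˡ (∑-words-monochromeFrom k r m b<k)) ⟩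
    ∑[ b ∈ upTo k ] (pow r b * pow r (m N.* b))
      ≈⟨ ∑-cong (upTo k) (λ b → ≈-trans (≈-sym (pow-+ r b (m N.* b))) (≈-sym (pow-pow r (suc m) b))) ⟩
    kint k (pow r (suc m)) ∎

  -- (p,q)-weights and binomial coefficients

  module _ (p q : Carrier) where

    pqWeight : ℕ → ℕ → Carrier
    pqWeight i j = pow q i * pow p j

    pqWeight-+ : ∀ i i′ j j′ → pqWeight (i N.+ i′) (j N.+ j′) ≈ pqWeight i j * pqWeight i′ j′
    pqWeight-+ i i′ j j′ = ≈-trans (*-cong (pow-+ q i i′) (pow-+ p j j′)) (*ᶜ.interchange _ _ _ _)

    weight : List ℕ → Carrier
    weight σ = pqWeight (Inversions.pairCount σ) (Coinversions.pairCount σ)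

    prefixWeight : List ℕ × List ℕ → Carrier
    prefixWeight (A , B) = pqWeight (Inversions.pairCount A N.+ Inversions.crossCount A B)
                                    (Coinversions.pairCount A N.+ Coinversions.crossCount A B)

    weight-++ : ∀ A {B τ} → τ ↭ B → weight (A ++ τ) ≈ prefixWeight (A , B) * weight τ
    weight-++ A {B} {τ} τ↭B =
      ≈-trans (reflexive (cong₂ pqWeight (Inversions.pairCount-++-↭ A τ↭B) (Coinversions.pairCount-++-↭ A τ↭B)))
              (pqWeight-+ (Inversions.pairCount A N.+ Inversions.crossCount A B) (Inversions.pairCount τ)
                          (Coinversions.pairCount A N.+ Coinversions.crossCount A B) (Coinversions.pairCount τ))

    prefixWeight-unpicked : ∀ {x} A B → All (_< x) A → prefixWeight (A , x ∷ B) ≈ pqWeight 0 (length A) * prefixWeight (A , B)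
    prefixWeight-unpicked {x} A B A<x =
      ≈-trans (reflexive (cong₂ pqWeight inversions coinversions))
              (pqWeight-+ 0 (Inversions.pairCount A N.+ Inversions.crossCount A B)
                          (length A) (Coinversions.pairCount A N.+ Coinversions.crossCount A B))
      where
      inversions : Inversions.pairCount A N.+ Inversions.crossCount A (x ∷ B) ≡ Inversions.pairCount A N.+ Inversions.crossCount A B
      inversions = cong (Inversions.pairCount A N.+_)
        (trans (Inversions.crossCount-∷ʳ A x B) (cong (N._+ Inversions.crossCount A B) (length-filter->-max A A<x)))
      coinversions : Coinversions.pairCount A N.+ Coinversions.crossCount A (x ∷ B)
                   ≡ length A N.+ (Coinversions.pairCount A N.+ Coinversions.crossCount A B)
      coinversions = +-exchange (Coinversions.pairCount A) (length A)
        (trans (Coinversions.crossCount-∷ʳ A x B) (cong (N._+ Coinversions.crossCount A B) (length-filter-<-max A A<x)))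

    prefixWeight-picked : ∀ {x} A B → All (_< x) A → All (_< x) B →
      prefixWeight (A ++ [ x ] , B) ≈ pqWeight (length B) (length A) * prefixWeight (A , B)
    prefixWeight-picked {x} A B A<x B<x =
      ≈-trans (reflexive (cong₂ pqWeight inversions coinversions))
              (pqWeight-+ (length B) (Inversions.pairCount A N.+ Inversions.crossCount A B)
                          (length A) (Coinversions.pairCount A N.+ Coinversions.crossCount A B))
      where
      inversions : Inversions.pairCount (A ++ [ x ]) N.+ Inversions.crossCount (A ++ [ x ]) B
                 ≡ length B N.+ (Inversions.pairCount A N.+ Inversions.crossCount A B)
      inversions = trans (Inversions.pairCount+crossCount-∷ʳ A x B)
        (cong (N._+ (Inversions.pairCount A N.+ Inversions.crossCount A B))
              (cong₂ N._+_ (length-filter->-max A A<x) (length-filter-<-max B B<x)))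
      coinversions : Coinversions.pairCount (A ++ [ x ]) N.+ Coinversions.crossCount (A ++ [ x ]) B
                   ≡ length A N.+ (Coinversions.pairCount A N.+ Coinversions.crossCount A B)
      coinversions = trans (Coinversions.pairCount+crossCount-∷ʳ A x B)
        (cong (N._+ (Coinversions.pairCount A N.+ Coinversions.crossCount A B))
              (trans (cong₂ N._+_ (length-filter-<-max A A<x) (length-filter->-max B B<x)) (NP.+-identityʳ (length A))))

    -- p^(m choose 2) times the (p,q)-binomial coefficient
    binomial : ℕ → ℕ → Carrier
    binomial n       zero    = 1#
    binomial zero    (suc m) = 0#
    binomial (suc n) (suc m) = pqWeight 0 (suc m) * binomial n (suc m) + pqWeight (n ∸ m) m * binomial n m

    ∑-selections-prefixWeight : ∀ ds → Decreasing ds → ∀ m → ∑ (selections ds m) prefixWeight ≈ binomial (length ds) m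
    ∑-selections-prefixWeight ds       dec        zero    = ≈-trans (+-identityʳ _) (*-identityˡ 1#)
    ∑-selections-prefixWeight []       dec        (suc m) = ≈-refl
    ∑-selections-prefixWeight (x ∷ xs) (x> ∷ dec) (suc m) = begin
      ∑ (selections (x ∷ xs) (suc m)) prefixWeight
        ≈⟨ ∑-selections-∷ x xs m prefixWeight ⟩
      ∑[ AB ∈ selections xs (suc m) ] prefixWeight (proj₁ AB , x ∷ proj₂ AB)
        + ∑[ AB ∈ selections xs m ] prefixWeight (proj₁ AB ++ [ x ] , proj₂ AB)
        ≈⟨ +-cong (∑-cong-All (All.zip (selections-length xs (suc m) , selections-bounded xs (suc m) x>)) unpicked)
                  (∑-cong-All (All.zip (All.zip (selections-length xs m , selections-length-rest xs m) , selections-bounded xs m x>))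
                              picked) ⟩
      ∑[ AB ∈ selections xs (suc m) ] (pqWeight 0 (suc m) * prefixWeight AB)
        + ∑[ AB ∈ selections xs m ] (pqWeight (length xs ∸ m) m * prefixWeight AB)
        ≈⟨ +-cong (*-distribˡ-∑ _ (selections xs (suc m)) prefixWeight) (*-distribˡ-∑ _ (selections xs m) prefixWeight) ⟨
      pqWeight 0 (suc m) * ∑ (selections xs (suc m)) prefixWeight + pqWeight (length xs ∸ m) m * ∑ (selections xs m) prefixWeight
        ≈⟨ +-cong (*-congˡ (∑-selections-prefixWeight xs dec (suc m))) (*-congˡ (∑-selections-prefixWeight xs dec m)) ⟩
      binomial (length (x ∷ xs)) (suc m) ∎
      where
      unpicked : ∀ {AB} → (length (proj₁ AB) ≡ suc m) × (All (_< x) (proj₁ AB) × All (_< x) (proj₂ AB)) →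
                 prefixWeight (proj₁ AB , x ∷ proj₂ AB) ≈ pqWeight 0 (suc m) * prefixWeight AB
      unpicked {A , B} (∣A∣≡ , A<x , _) =
        ≈-trans (prefixWeight-unpicked A B A<x) (*-congʳ (reflexive (cong (pqWeight 0) ∣A∣≡)))
      picked : ∀ {AB} → ((length (proj₁ AB) ≡ m) × (length (proj₂ AB) ≡ length xs ∸ m)) × (All (_< x) (proj₁ AB) × All (_< x) (proj₂ AB)) →
               prefixWeight (proj₁ AB ++ [ x ] , proj₂ AB) ≈ pqWeight (length xs ∸ m) m * prefixWeight AB
      picked {A , B} ((∣A∣≡ , ∣B∣≡) , A<x , B<x) =
        ≈-trans (prefixWeight-picked A B A<x B<x) (*-congʳ (reflexive (cong₂ pqWeight ∣B∣≡ ∣A∣≡)))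

    qint-suc : ∀ n → qint p q (suc n) ≈ pow p n + q * qint p q n
    qint-suc n = begin
      qint p q (suc n)                                               ≈⟨ ∑<≈∑-upTo (suc n) _ ⟨
      pow p n * 1# + ∑[ i < n ] (pow p (n ∸ suc i) * (q * pow q i))  ≈⟨ +-cong (*-identityʳ _) (∑<-cong n λ i _ → *ᶜ.x∙yz≈y∙xz _ q _) ⟩
      pow p n + ∑[ i < n ] (q * (pow p (n ∸ suc i) * pow q i))       ≈⟨ +-congˡ (*-distribˡ-∑< q n _) ⟨
      pow p n + q * ∑[ i < n ] (pow p (n ∸ suc i) * pow q i)         ≈⟨ +-congˡ (*-congˡ (∑<≈∑-upTo n _)) ⟩
      pow p n + q * qint p q n                                       ∎

    qint-+ : ∀ a b → qint p q (a N.+ b) ≈ pow p b * qint p q a + pow q a * qint p q b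
    qint-+ zero    b = ≈-sym (≈-trans (+-cong (zeroʳ _) (*-identityˡ _)) (+-identityˡ _))
    qint-+ (suc a) b = begin
      qint p q (suc a N.+ b)                                                  ≈⟨ qint-suc (a N.+ b) ⟩
      pow p (a N.+ b) + q * qint p q (a N.+ b)                                ≈⟨ +-cong (pow-+ p a b) (*-congˡ (qint-+ a b)) ⟩
      pow p a * pow p b + q * (pow p b * qint p q a + pow q a * qint p q b)   ≈⟨ rearrange _ _ _ _ _ _ ⟩
      pow p b * (pow p a + q * qint p q a) + (q * pow q a) * qint p q b       ≈⟨ +-congʳ (*-congˡ (qint-suc a)) ⟨
      pow p b * qint p q (suc a) + pow q (suc a) * qint p q b                 ∎
      where
      rearrange : ∀ x y z u v w → x * y + z * (y * u + v * w) ≈ y * (x + z * u) + (z * v) * w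
      rearrange = solve 6 (λ x y z u v w → x :* y :+ z :* (y :* u :+ v :* w) := y :* (x :+ z :* u) :+ (z :* v) :* w) ≈-refl

    binomial-overflow : ∀ n m → n < m → binomial n m ≈ 0#
    binomial-overflow zero    (suc m) _           = ≈-refl
    binomial-overflow (suc n) (suc m) (s≤s n<m) = ≈-trans
      (+-cong (*-congˡ (binomial-overflow n (suc m) (NP.m<n⇒m<1+n n<m))) (*-congˡ (binomial-overflow n m n<m)))
      (≈-trans (+-cong (zeroʳ _) (zeroʳ _)) (+-identityˡ 0#))

    pow-C2-suc : ∀ m → pow p (suc m C 2) ≈ pow p m * pow p (m C 2)
    pow-C2-suc m = ≈-trans (reflexive (cong (pow p) (trans (sym (nCk+nC[k+1]≡[n+1]C[k+1] m 1)) (cong (N._+ m C 2) (nC1≡n m)))))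
                           (pow-+ p m (m C 2))

    private
      qfact-pair : ℕ → ℕ → Carrier
      qfact-pair i j = qfact p q i * qfact p q j

      unpicked-< : ∀ n m → m < n →
        binomial n (suc m) * qfact-pair (suc m) (n ∸ suc m) ≈ pow p (suc m C 2) * qfact p q n →
        pqWeight 0 (suc m) * binomial n (suc m) * qfact-pair (suc m) (n ∸ m)
          ≈ pow p (suc m) * qint p q (n ∸ m) * (pow p (suc m C 2) * qfact p q n)
      unpicked-< n m m<n ih rewrite NP.+-∸-assoc 1 m<n = begin
        1# * pow p (suc m) * binomial n (suc m) * (qfact p q (suc m) * (qint p q (suc k) * qfact p q k))
          ≈⟨ *-congʳ (*-congʳ (*-identityˡ _)) ⟩
        pow p (suc m) * binomial n (suc m) * (qfact p q (suc m) * (qint p q (suc k) * qfact p q k))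
          ≈⟨ rearrange _ _ _ _ _ ⟩
        pow p (suc m) * qint p q (suc k) * (binomial n (suc m) * (qfact p q (suc m) * qfact p q k))
          ≈⟨ *-congˡ ih ⟩
        pow p (suc m) * qint p q (suc k) * (pow p (suc m C 2) * qfact p q n) ∎
        where
        k = n ∸ suc m
        rearrange : ∀ x b s i t → x * b * (s * (i * t)) ≈ x * i * (b * (s * t))
        rearrange = solve 5 (λ x b s i t → x :* b :* (s :* (i :* t)) := x :* i :* (b :* (s :* t))) ≈-refl

      unpicked-≡ : ∀ n →
        pqWeight 0 (suc n) * binomial n (suc n) * qfact-pair (suc n) (n ∸ n)
          ≈ pow p (suc n) * qint p q (n ∸ n) * (pow p (suc n C 2) * qfact p q n)
      unpicked-≡ n rewrite NP.n∸n≡0 n = begin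
        pqWeight 0 (suc n) * binomial n (suc n) * qfact-pair (suc n) 0 ≈⟨ *-congʳ (*-congˡ (binomial-overflow n (suc n) (NP.n<1+n n))) ⟩
        pqWeight 0 (suc n) * 0# * qfact-pair (suc n) 0                  ≈⟨ ≈-trans (*-congʳ (zeroʳ _)) (zeroˡ _) ⟩
        0#                                                               ≈⟨ ≈-trans (*-congʳ (zeroʳ _)) (zeroˡ _) ⟨
        pow p (suc n) * 0# * (pow p (suc n C 2) * qfact p q n)           ∎

      picked : ∀ n m →
        binomial n m * qfact-pair m (n ∸ m) ≈ pow p (m C 2) * qfact p q n →
        pqWeight (n ∸ m) m * binomial n m * qfact-pair (suc m) (n ∸ m)
          ≈ pow q (n ∸ m) * qint p q (suc m) * (pow p (suc m C 2) * qfact p q n)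
      picked n m ih = begin
        pow q (n ∸ m) * pow p m * binomial n m * (qint p q (suc m) * qfact p q m * qfact p q (n ∸ m))
          ≈⟨ rearrange _ _ _ _ _ _ ⟩
        pow q (n ∸ m) * qint p q (suc m) * (pow p m * (binomial n m * qfact-pair m (n ∸ m)))
          ≈⟨ *-congˡ (*-congˡ ih) ⟩
        pow q (n ∸ m) * qint p q (suc m) * (pow p m * (pow p (m C 2) * qfact p q n))
          ≈⟨ *-congˡ (≈-trans (≈-sym (*-assoc _ _ _)) (*-congʳ (≈-sym (pow-C2-suc m)))) ⟩
        pow q (n ∸ m) * qint p q (suc m) * (pow p (suc m C 2) * qfact p q n) ∎
        where
        rearrange : ∀ a x b i s t → a * x * b * (i * s * t) ≈ a * i * (x * (b * (s * t)))
        rearrange = solve 6 (λ a x b i s t → a :* x :* b :* (i :* s :* t) := a :* i :* (x :* (b :* (s :* t)))) ≈-refl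

    binomial-qfact : ∀ n m → m ≤ n → binomial n m * (qfact p q m * qfact p q (n ∸ m)) ≈ pow p (m C 2) * qfact p q n
    binomial-qfact n       zero    _         = *-identityˡ _
    binomial-qfact (suc n) (suc m) (s≤s m≤n) = begin
      (pqWeight 0 (suc m) * binomial n (suc m) + pqWeight (n ∸ m) m * binomial n m) * qfact-pair (suc m) (n ∸ m)
        ≈⟨ distribʳ _ _ _ ⟩
      pqWeight 0 (suc m) * binomial n (suc m) * qfact-pair (suc m) (n ∸ m)
        + pqWeight (n ∸ m) m * binomial n m * qfact-pair (suc m) (n ∸ m)
        ≈⟨ +-cong unpicked (picked n m (binomial-qfact n m m≤n)) ⟩
      pow p (suc m) * qint p q (n ∸ m) * D + pow q (n ∸ m) * qint p q (suc m) * D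
        ≈⟨ distribʳ D _ _ ⟨
      (pow p (suc m) * qint p q (n ∸ m) + pow q (n ∸ m) * qint p q (suc m)) * D
        ≈⟨ *-congʳ (qint-+ (n ∸ m) (suc m)) ⟨
      qint p q ((n ∸ m) N.+ suc m) * D
        ≈⟨ reflexive (cong (λ j → qint p q j * D) (trans (NP.+-suc (n ∸ m) m) (cong suc (NP.m∸n+n≡m m≤n)))) ⟩
      qint p q (suc n) * (pow p (suc m C 2) * qfact p q n)
        ≈⟨ *ᶜ.x∙yz≈y∙xz _ _ _ ⟩
      pow p (suc m C 2) * qfact p q (suc n) ∎
      where
      D = pow p (suc m C 2) * qfact p q n
      unpicked : pqWeight 0 (suc m) * binomial n (suc m) * qfact-pair (suc m) (n ∸ m) ≈ pow p (suc m) * qint p q (n ∸ m) * D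
      unpicked with NP.m≤n⇒m<n∨m≡n m≤n
      ... | inj₁ m<n  = unpicked-< n m m<n (binomial-qfact n (suc m) m<n)
      ... | inj₂ refl = unpicked-≡ n

  -- The recurrence for the wreath sums

  module _ (k : ℕ) (p q r : Carrier) where

    colouredSum : List ℕ → ℕ → Carrier
    colouredSum τ n = ∑[ v ∈ words k n ] (pow r (norm v) * wrisFree (zip τ v))

    blockColouredSum : ℕ → ℕ → List ℕ → Carrier
    blockColouredSum n m τ =
      ∑[ v ∈ words k n ] (pow r (norm v) * (𝟙 (chainPrefix equal m v) * wrisFree (zip (drop m τ) (drop m v))))

    wreathSumOf : List ℕ → Carrier
    wreathSumOf ds = ∑[ τ ∈ permutationsOf ds ] (weight p q τ * colouredSum τ (length ds))

    colouredSum-inclusionExclusion : ∀ n τ → length τ ≡ suc n → colouredSum τ (suc n)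
      ≈ ∑[ i < suc n ] (sgn i * (𝟙 (chainPrefix increasing (suc i) τ) * blockColouredSum (suc n) (suc i) τ))
    colouredSum-inclusionExclusion n τ ∣τ∣≡ = begin
      ∑[ v ∈ words k (suc n) ] (pow r (norm v) * wrisFree (zip τ v))
        ≈⟨ ∑-cong-All (words-length k (suc n)) (λ {v} ∣v∣≡ → *-congˡ (wrisFree-inclusionExclusion (zip τ v) (length-zip τ v ∣τ∣≡ ∣v∣≡))) ⟩
      ∑[ v ∈ words k (suc n) ] (pow r (norm v) * ∑[ i < suc n ] term v i)
        ≈⟨ ∑-cong (words k (suc n)) (λ v → *-distribˡ-∑< (pow r (norm v)) (suc n) (term v)) ⟩
      ∑[ v ∈ words k (suc n) ] ∑[ i < suc n ] (pow r (norm v) * term v i)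
        ≈⟨ ∑-∑< (words k (suc n)) (suc n) (λ v i → pow r (norm v) * term v i) ⟩
      ∑[ i < suc n ] ∑[ v ∈ words k (suc n) ] (pow r (norm v) * term v i)
        ≈⟨ ∑<-cong (suc n) (λ i _ → ∑-cong (words k (suc n)) (split i)) ⟩
      ∑[ i < suc n ] ∑[ v ∈ words k (suc n) ] (sgn i * (𝟙 (chainPrefix increasing (suc i) τ) * block i v))
        ≈⟨ ∑<-cong (suc n) (λ i _ → ≈-trans (≈-sym (*-distribˡ-∑ (sgn i) (words k (suc n)) _))
                                              (*-congˡ (≈-sym (*-distribˡ-∑ (𝟙 (chainPrefix increasing (suc i) τ)) (words k (suc n)) (block i))))) ⟩
      ∑[ i < suc n ] (sgn i * (𝟙 (chainPrefix increasing (suc i) τ) * blockColouredSum (suc n) (suc i) τ)) ∎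
      where
      term : List ℕ → ℕ → Carrier
      term v i = sgn i * (𝟙 (chainPrefix (increasing ⊗ equal) (suc i) (zip τ v)) * wrisFree (drop (suc i) (zip τ v)))
      block : ℕ → List ℕ → Carrier
      block i v = pow r (norm v) * (𝟙 (chainPrefix equal (suc i) v) * wrisFree (zip (drop (suc i) τ) (drop (suc i) v)))
      rearrange : ∀ x s a b w → x * (s * ((a * b) * w)) ≈ s * (a * (x * (b * w)))
      rearrange = solve 5 (λ x s a b w → x :* (s :* ((a :* b) :* w)) := s :* (a :* (x :* (b :* w)))) ≈-refl
      split : ∀ i v → pow r (norm v) * term v i ≈ sgn i * (𝟙 (chainPrefix increasing (suc i) τ) * block i v)
      split i v = ≈-trans
        (*-congˡ (*-congˡ (*-cong (≈-trans (reflexive (cong 𝟙 (chainPrefix-zip increasing equal (suc i) τ v)))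
                                           (𝟙-∧ (chainPrefix increasing (suc i) τ) (chainPrefix equal (suc i) v)))
                                  (reflexive (cong wrisFree (drop-zip (suc i) τ v))))))
        (rearrange _ _ _ _ _)

    blockColouredSum-++ : ∀ i A τ n → length A ≡ suc i →
      blockColouredSum (suc i N.+ n) (suc i) (A ++ τ) ≈ kint k (pow r (suc i)) * colouredSum τ n
    blockColouredSum-++ i A τ n ∣A∣≡ = begin
      blockColouredSum (suc i N.+ n) (suc i) (A ++ τ)
        ≈⟨ ∑-words-+ k (suc i) n _ ⟩
      ∑[ u ∈ words k (suc i) ] ∑[ v ∈ words k n ] block (u ++ v)
        ≈⟨ ∑-cong-All (words-length k (suc i)) (λ {u} ∣u∣≡ → ∑-cong (words k n) (split u ∣u∣≡)) ⟩
      ∑[ u ∈ words k (suc i) ] ∑[ v ∈ words k n ] (monochrome u * (pow r (norm v) * wrisFree (zip τ v)))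
        ≈⟨ ∑-cong (words k (suc i)) (λ u → *-distribˡ-∑ (monochrome u) (words k n) _) ⟨
      ∑[ u ∈ words k (suc i) ] (monochrome u * colouredSum τ n)
        ≈⟨ *-distribʳ-∑ (colouredSum τ n) (words k (suc i)) monochrome ⟨
      ∑ (words k (suc i)) monochrome * colouredSum τ n
        ≈⟨ *-congʳ (∑-words-monochrome k r i) ⟩
      kint k (pow r (suc i)) * colouredSum τ n ∎
      where
      block : List ℕ → Carrier
      block v = pow r (norm v) * (𝟙 (chainPrefix equal (suc i) v) * wrisFree (zip (drop (suc i) (A ++ τ)) (drop (suc i) v)))
      monochrome : List ℕ → Carrier
      monochrome u = pow r (norm u) * 𝟙 (chainPrefix equal (suc i) u)
      dropPrefix : ∀ {B : Set} (u v : List B) → length u ≡ suc i → drop (suc i) (u ++ v) ≡ v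
      dropPrefix u v ∣u∣≡ = trans (cong (λ j → drop j (u ++ v)) (sym ∣u∣≡)) (drop-++ u v)
      split : ∀ u → length u ≡ suc i → ∀ v → block (u ++ v) ≈ monochrome u * (pow r (norm v) * wrisFree (zip τ v))
      split u ∣u∣≡ v = ≈-trans
        (*-cong (≈-trans (reflexive (cong (pow r) (sum-++ u v))) (pow-+ r (norm u) (norm v)))
                (*-congˡ (reflexive (cong₂ (λ σ w → wrisFree (zip σ w)) (dropPrefix A τ ∣A∣≡) (dropPrefix u v ∣u∣≡)))))
        (≈-trans (*-congˡ (*-congʳ (reflexive (cong 𝟙 (trans (cong (λ j → chainPrefix equal j (u ++ v)) (sym ∣u∣≡))
                                                             (trans (chainPrefix-++ equal u v) (cong (λ j → chainPrefix equal j u) ∣u∣≡)))))))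
                 (*ᶜ.interchange _ _ _ _))

    prefixedSum-blockColouredSum : ∀ i {N} A B → length A ≡ suc i → length A N.+ length B ≡ N →
      prefixedSum (λ σ → weight p q σ * blockColouredSum N (suc i) σ) (A , B)
        ≈ prefixWeight p q (A , B) * (kint k (pow r (suc i)) * wreathSumOf B)
    prefixedSum-blockColouredSum i A B ∣A∣≡ refl = begin
      ∑[ τ ∈ permutationsOf B ] (weight p q (A ++ τ) * blockColouredSum (length A N.+ length B) (suc i) (A ++ τ))
        ≈⟨ ∑-cong-All (permutationsOf-↭ B) (λ {τ} τ↭B → *-cong (weight-++ p q A τ↭B) (block τ)) ⟩
      ∑[ τ ∈ permutationsOf B ] ((prefixWeight p q (A , B) * weight p q τ) * (K * colouredSum τ (length B)))
        ≈⟨ ∑-cong (permutationsOf B) (λ τ → rearrange _ _ _ _) ⟩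
      ∑[ τ ∈ permutationsOf B ] (prefixWeight p q (A , B) * (K * (weight p q τ * colouredSum τ (length B))))
        ≈⟨ ≈-trans (*-congˡ (*-distribˡ-∑ K (permutationsOf B) _)) (*-distribˡ-∑ (prefixWeight p q (A , B)) (permutationsOf B) _) ⟨
      prefixWeight p q (A , B) * (K * wreathSumOf B) ∎
      where
      K = kint k (pow r (suc i))
      block : ∀ τ → blockColouredSum (length A N.+ length B) (suc i) (A ++ τ) ≈ K * colouredSum τ (length B)
      block τ = ≈-trans (reflexive (cong (λ j → blockColouredSum (j N.+ length B) (suc i) (A ++ τ)) ∣A∣≡))
                        (blockColouredSum-++ i A τ (length B) ∣A∣≡)
      rearrange : ∀ a w c x → (a * w) * (c * x) ≈ a * (c * (w * x))
      rearrange = solve 4 (λ a w c x → (a :* w) :* (c :* x) := a :* (c :* (w :* x))) ≈-refl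

    wreathSumOf-selections : ∀ ds → Decreasing ds → ∀ n → length ds ≡ suc n → wreathSumOf ds
      ≈ ∑[ i < suc n ] (sgn i * (kint k (pow r (suc i)) * ∑[ AB ∈ selections ds (suc i) ] (prefixWeight p q AB * wreathSumOf (proj₂ AB))))
    wreathSumOf-selections ds dec n ∣ds∣≡ = begin
      ∑[ τ ∈ permutationsOf ds ] (weight p q τ * colouredSum τ (length ds))
        ≈⟨ ∑-cong-All (permutationsOf-↭ ds) (λ {τ} τ↭ds → expand τ (trans (↭-length τ↭ds) ∣ds∣≡)) ⟩
      ∑[ τ ∈ permutationsOf ds ] ∑[ i < suc n ] (sgn i * increasingPart i τ)
        ≈⟨ ∑-∑< (permutationsOf ds) (suc n) (λ τ i → sgn i * increasingPart i τ) ⟩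
      ∑[ i < suc n ] ∑[ τ ∈ permutationsOf ds ] (sgn i * increasingPart i τ)
        ≈⟨ ∑<-cong (suc n) (λ i _ → *-distribˡ-∑ (sgn i) (permutationsOf ds) (increasingPart i)) ⟨
      ∑[ i < suc n ] (sgn i * ∑ (permutationsOf ds) (increasingPart i))
        ≈⟨ ∑<-cong (suc n) (λ i _ → *-congˡ {sgn i} (≈-trans (∑-permutationsOf-increasingPrefix ds dec (suc i) (G i))
                                                      (∑-selections-prefixedSum i))) ⟩
      ∑[ i < suc n ] (sgn i * (K i * ∑[ AB ∈ selections ds (suc i) ] (prefixWeight p q AB * wreathSumOf (proj₂ AB)))) ∎
      where
      K : ℕ → Carrier
      K i = kint k (pow r (suc i))
      G : ℕ → List ℕ → Carrier
      G i τ = weight p q τ * blockColouredSum (suc n) (suc i) τ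
      increasingPart : ℕ → List ℕ → Carrier
      increasingPart i τ = 𝟙 (chainPrefix increasing (suc i) τ) * G i τ

      expand : ∀ τ → length τ ≡ suc n → weight p q τ * colouredSum τ (length ds) ≈ ∑[ i < suc n ] (sgn i * increasingPart i τ)
      expand τ ∣τ∣≡ = begin
        weight p q τ * colouredSum τ (length ds)
          ≈⟨ *-congˡ (≈-trans (reflexive (cong (colouredSum τ) ∣ds∣≡)) (colouredSum-inclusionExclusion n τ ∣τ∣≡)) ⟩
        weight p q τ * ∑[ i < suc n ] (sgn i * (𝟙 (chainPrefix increasing (suc i) τ) * blockColouredSum (suc n) (suc i) τ))
          ≈⟨ *-distribˡ-∑< (weight p q τ) (suc n) (λ i → sgn i * (𝟙 (chainPrefix increasing (suc i) τ) * block i)) ⟩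
        ∑[ i < suc n ] (weight p q τ * (sgn i * (𝟙 (chainPrefix increasing (suc i) τ) * block i)))
          ≈⟨ ∑<-cong (suc n) (λ i _ → ≈-trans (*ᶜ.x∙yz≈y∙xz (weight p q τ) (sgn i) _)
                                              (*-congˡ (*ᶜ.x∙yz≈y∙xz (weight p q τ) (𝟙 (chainPrefix increasing (suc i) τ)) (block i)))) ⟩
        ∑[ i < suc n ] (sgn i * increasingPart i τ) ∎
        where
        block : ℕ → Carrier
        block i = blockColouredSum (suc n) (suc i) τ

      ∑-selections-prefixedSum : ∀ i → ∑ (selections ds (suc i)) (prefixedSum (G i))
        ≈ K i * ∑[ AB ∈ selections ds (suc i) ] (prefixWeight p q AB * wreathSumOf (proj₂ AB))
      ∑-selections-prefixedSum i = begin
        ∑ (selections ds (suc i)) (prefixedSum (G i))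
          ≈⟨ ∑-cong-All (All.zip (selections-length ds (suc i) , selections-↭ ds (suc i)))
                        (λ {(A , B)} (∣A∣≡ , ↭ds) → prefixedSum-blockColouredSum i A B ∣A∣≡
                                                      (trans (sym (LP.length-++ A)) (trans (↭-length ↭ds) ∣ds∣≡))) ⟩
        ∑[ AB ∈ selections ds (suc i) ] (prefixWeight p q AB * (K i * wreathSumOf (proj₂ AB)))
          ≈⟨ ∑-cong (selections ds (suc i)) (λ AB → *ᶜ.x∙yz≈y∙xz (prefixWeight p q AB) (K i) (wreathSumOf (proj₂ AB))) ⟩
        ∑[ AB ∈ selections ds (suc i) ] (K i * (prefixWeight p q AB * wreathSumOf (proj₂ AB)))
          ≈⟨ *-distribˡ-∑ (K i) (selections ds (suc i)) _ ⟨
        K i * ∑[ AB ∈ selections ds (suc i) ] (prefixWeight p q AB * wreathSumOf (proj₂ AB)) ∎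

    wreathSum≈wreathSumOf : ∀ n → wreathSum k p q r n ≈ wreathSumOf (applyDownFrom suc n)
    wreathSum≈wreathSumOf n = begin
      wreathSum k p q r n
        ≈⟨ ∑-filter (λ x → wris x ≟ 0) (wreath k n) _ ⟩
      ∑[ σw ∈ wreath k n ] (𝟙 (does (wris σw ≟ 0)) * term σw)
        ≈⟨ ∑-concatMap (λ σ → map (σ ,_) (words k n)) (perms n) _ ⟩
      ∑[ σ ∈ perms n ] ∑ (map (σ ,_) (words k n)) (λ σw → 𝟙 (does (wris σw ≟ 0)) * term σw)
        ≈⟨ ∑-cong (perms n) (λ σ → ≈-trans (∑-map (σ ,_) (words k n) _) (∑-cong (words k n) (λ w → rearrange σ w))) ⟩
      ∑[ σ ∈ perms n ] ∑[ w ∈ words k n ] (weight p q σ * (pow r (norm w) * wrisFree (zip σ w)))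
        ≈⟨ ∑-cong (perms n) (λ σ → *-distribˡ-∑ (weight p q σ) (words k n) _) ⟨
      ∑[ σ ∈ perms n ] (weight p q σ * colouredSum σ n)
        ≈⟨ reflexive (cong₂ (λ σs m → ∑[ σ ∈ σs ] (weight p q σ * colouredSum σ m))
                            (perms≡permutationsOf n) (sym (LP.length-applyDownFrom suc n))) ⟩
      wreathSumOf (applyDownFrom suc n) ∎
      where
      term : List ℕ × List ℕ → Carrier
      term (σ , w) = pow q (inv σ) * pow p (coinv σ) * pow r (norm w)
      rearrange : ∀ σ w → 𝟙 (does (wris (σ , w) ≟ 0)) * term (σ , w) ≈ weight p q σ * (pow r (norm w) * wrisFree (zip σ w))
      rearrange σ w = ≈-trans (*-comm _ _) (≈-trans (*-assoc _ _ _)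
        (*-congʳ (reflexive (cong₂ (pqWeight p q) (inv≡pairCount σ) (coinv≡pairCount σ)))))

    wreathRecurrence : ℕ → Carrier
    wreathRecurrence n = ∑[ i < suc n ] (sgn i * (kint k (pow r (suc i)) * (binomial p q (suc n) (suc i) * wreathSum k p q r (n ∸ i))))

    private
      wreathSumOf-recurrence : ∀ n → (∀ {m} → m < suc n → ∀ ds → Decreasing ds → length ds ≡ m → wreathSumOf ds ≈ wreathSum k p q r m) →
        ∀ ds → Decreasing ds → length ds ≡ suc n → wreathSumOf ds ≈ wreathRecurrence n
      wreathSumOf-recurrence n ih ds dec ∣ds∣≡ = ≈-trans (wreathSumOf-selections ds dec n ∣ds∣≡)
        (∑<-cong (suc n) λ i _ → *-congˡ {sgn i} (*-congˡ {kint k (pow r (suc i))} (begin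
          ∑[ AB ∈ selections ds (suc i) ] (prefixWeight p q AB * wreathSumOf (proj₂ AB))
            ≈⟨ ∑-cong-All (All.zip (selections-length-rest ds (suc i) , selections-decreasing ds (suc i) dec))
                          (λ {(A , B)} (∣B∣≡ , B↓) → *-congˡ (ih (s≤s (NP.m∸n≤m n i)) B B↓ (trans ∣B∣≡ (cong (_∸ suc i) ∣ds∣≡)))) ⟩
          ∑[ AB ∈ selections ds (suc i) ] (prefixWeight p q AB * wreathSum k p q r (n ∸ i))
            ≈⟨ *-distribʳ-∑ _ (selections ds (suc i)) (prefixWeight p q) ⟨
          ∑ (selections ds (suc i)) (prefixWeight p q) * wreathSum k p q r (n ∸ i)
            ≈⟨ *-congʳ (≈-trans (∑-selections-prefixWeight p q ds dec (suc i)) (reflexive (cong (λ m → binomial p q m (suc i)) ∣ds∣≡))) ⟩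
          binomial p q (suc n) (suc i) * wreathSum k p q r (n ∸ i) ∎)))

    wreathSumOf≈wreathSum : ∀ ds → Decreasing ds → wreathSumOf ds ≈ wreathSum k p q r (length ds)
    wreathSumOf≈wreathSum ds dec = <-rec P step (length ds) ds dec refl
      where
      P : ℕ → Set _
      P m = ∀ ds → Decreasing ds → length ds ≡ m → wreathSumOf ds ≈ wreathSum k p q r m
      step : ∀ m → (∀ {j} → j < m → P j) → P m
      step zero    ih []   _   _     = ≈-sym (wreathSum≈wreathSumOf 0)
      step (suc n) ih ds   dec ∣ds∣≡ = begin
        wreathSumOf ds                              ≈⟨ wreathSumOf-recurrence n ih ds dec ∣ds∣≡ ⟩
        wreathRecurrence n                          ≈⟨ wreathSumOf-recurrence n ih _ (applyDownFrom-decreasing (suc n))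
                                                                              (LP.length-applyDownFrom suc (suc n)) ⟨
        wreathSumOf (applyDownFrom suc (suc n))     ≈⟨ wreathSum≈wreathSumOf (suc n) ⟨
        wreathSum k p q r (suc n)                   ∎

    wreathSum-recurrence : ∀ n → wreathSum k p q r (suc n) ≈ wreathRecurrence n
    wreathSum-recurrence n = ≈-trans (wreathSum≈wreathSumOf (suc n))
      (wreathSumOf-recurrence n (λ _ ds dec → λ { refl → wreathSumOf≈wreathSum ds dec })
                              _ (applyDownFrom-decreasing (suc n)) (LP.length-applyDownFrom suc (suc n)))

  -- The generating-function identity

  conv-suc : ∀ f g n → conv f g (suc n) ≈ ∑[ i < suc n ] (f (n ∸ i) * g (suc i)) + f (suc n) * g 0
  conv-suc f g n = begin
    conv f g (suc n)
      ≈⟨ ∑<≈∑-upTo (suc (suc n)) _ ⟨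
    ∑[ j < suc (suc n) ] (f j * g (suc n ∸ j))
      ≈⟨ ∑<-last (suc n) (λ j → f j * g (suc n ∸ j)) ⟩
    ∑[ j < suc n ] (f j * g (suc n ∸ j)) + f (suc n) * g (suc n ∸ suc n)
      ≈⟨ +-cong (∑<-reverse (suc n) (λ j → f j * g (suc n ∸ j))) (reflexive (cong (λ j → f (suc n) * g j) (NP.n∸n≡0 n))) ⟩
    ∑[ i < suc n ] (f (n ∸ i) * g (suc n ∸ (n ∸ i))) + f (suc n) * g 0
      ≈⟨ +-congʳ (∑<-cong (suc n) λ i i<1+n → reflexive (cong (λ j → f (n ∸ i) * g j)
                   (trans (NP.+-∸-assoc 1 (NP.m∸n≤m n i)) (cong suc (NP.m∸[m∸n]≡n (NP.≤-pred i<1+n)))))) ⟩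
    ∑[ i < suc n ] (f (n ∸ i) * g (suc i)) + f (suc n) * g 0 ∎

  module _ (k : ℕ) (p q r : Carrier) (ifac : ℕ → Carrier) (ifac-inverse : ∀ n → ifac n * qfact p q n ≈ 1#) where

    ifac-binomial : ∀ n m → m ≤ n → ifac n * binomial p q n m ≈ pow p (m C 2) * (ifac m * ifac (n ∸ m))
    ifac-binomial n m m≤n = begin
      ifac n * binomial p q n m
        ≈⟨ *-identityʳ _ ⟨
      ifac n * binomial p q n m * 1#
        ≈⟨ *-congˡ (≈-trans (*-cong (ifac-inverse m) (ifac-inverse (n ∸ m))) (*-identityˡ 1#)) ⟨
      ifac n * binomial p q n m * ((ifac m * qfact p q m) * (ifac (n ∸ m) * qfact p q (n ∸ m)))
        ≈⟨ rearrange _ _ _ _ _ _ ⟩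
      ifac n * (binomial p q n m * (qfact p q m * qfact p q (n ∸ m))) * (ifac m * ifac (n ∸ m))
        ≈⟨ *-congʳ (*-congˡ (binomial-qfact p q n m m≤n)) ⟩
      ifac n * (pow p (m C 2) * qfact p q n) * (ifac m * ifac (n ∸ m))
        ≈⟨ *-congʳ (≈-trans (*ᶜ.x∙yz≈y∙xz _ _ _) (≈-trans (*-congˡ (ifac-inverse n)) (*-identityʳ _))) ⟩
      pow p (m C 2) * (ifac m * ifac (n ∸ m)) ∎
      where
      rearrange : ∀ a b c d e f → a * b * ((c * d) * (e * f)) ≈ a * (b * (d * f)) * (c * e)
      rearrange = solve 6 (λ a b c d e f → a :* b :* ((c :* d) :* (e :* f)) := a :* (b :* (d :* f)) :* (c :* e)) ≈-refl

    L D : ℕ → Carrier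
    L = lhsSeries k p q r ifac
    D = denSeries k p q r ifac

    -- the i-th term of the recurrence for wreathSum (suc n), divided by [n+1]!
    recurrenceTerm : ℕ → ℕ → Carrier
    recurrenceTerm n i = sgn i * (kint k (pow r (suc i)) * ((pow p (suc i C 2) * (ifac (suc i) * ifac (n ∸ i))) * wreathSum k p q r (n ∸ i)))

    lhsSeries-suc : ∀ n → L (suc n) ≈ ∑[ i < suc n ] recurrenceTerm n i
    lhsSeries-suc n = begin
      ifac (suc n) * wreathSum k p q r (suc n)
        ≈⟨ *-congˡ (wreathSum-recurrence k p q r n) ⟩
      ifac (suc n) * wreathRecurrence k p q r n
        ≈⟨ *-distribˡ-∑< (ifac (suc n)) (suc n) term ⟩
      ∑[ i < suc n ] (ifac (suc n) * term i)
        ≈⟨ ∑<-cong (suc n) (λ i i<1+n → ≈-trans (rearrange (ifac (suc n)) (sgn i) (kint k (pow r (suc i)))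
                                                            (binomial p q (suc n) (suc i)) (wreathSum k p q r (n ∸ i)))
                                                 (*-congˡ (*-congˡ (*-congʳ (ifac-binomial (suc n) (suc i) i<1+n))))) ⟩
      ∑[ i < suc n ] recurrenceTerm n i ∎
      where
      term : ℕ → Carrier
      term i = sgn i * (kint k (pow r (suc i)) * (binomial p q (suc n) (suc i) * wreathSum k p q r (n ∸ i)))
      rearrange : ∀ f s K b w → f * (s * (K * (b * w))) ≈ s * (K * ((f * b) * w))
      rearrange = solve 5 (λ f s K b w → f :* (s :* (K :* (b :* w))) := s :* (K :* ((f :* b) :* w))) ≈-refl

    lhsSeries-denSeries : ∀ n i → L (n ∸ i) * D (suc i) ≈ - recurrenceTerm n i
    lhsSeries-denSeries n i = ≈-trans (rearrange _ _ _ _ _ _ _) (-1*x≈-x _)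
      where
      rearrange : ∀ a w c m s b K → (a * w) * (((c * (m * s)) * b) * K) ≈ m * (s * (K * ((c * (b * a)) * w)))
      rearrange = solve 7 (λ a w c m s b K → (a :* w) :* (((c :* (m :* s)) :* b) :* K) := m :* (s :* (K :* ((c :* (b :* a)) :* w)))) ≈-refl

    conv-lhsSeries-denSeries : ∀ n → conv L D n ≈ oneSeries n
    conv-lhsSeries-denSeries zero    = ≈-trans (+-identityʳ _) (≈-trans (*-identityʳ _) (≈-trans (*-congˡ wreathSum-zero) (ifac-inverse 0)))
      where
      wreathSum-zero : wreathSum k p q r 0 ≈ 1#
      wreathSum-zero = ≈-trans (+-identityʳ _) (≈-trans (*-identityʳ _) (*-identityˡ 1#))
    conv-lhsSeries-denSeries (suc n) = begin
      conv L D (suc n)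
        ≈⟨ conv-suc L D n ⟩
      ∑[ i < suc n ] (L (n ∸ i) * D (suc i)) + L (suc n) * 1#
        ≈⟨ +-cong (∑<-cong (suc n) λ i _ → lhsSeries-denSeries n i) (≈-trans (*-identityʳ _) (lhsSeries-suc n)) ⟩
      ∑[ i < suc n ] (- recurrenceTerm n i) + ∑[ i < suc n ] recurrenceTerm n i
        ≈⟨ ∑<-+ (suc n) (λ i → - recurrenceTerm n i) (recurrenceTerm n) ⟨
      ∑[ i < suc n ] (- recurrenceTerm n i + recurrenceTerm n i)
        ≈⟨ ∑<-zero (suc n) (λ i _ → -‿inverseˡ (recurrenceTerm n i)) ⟩
      0# ∎

corollary12 : ∀ {c ℓ : Level} (R : CommutativeRing c ℓ) →
    let open CommutativeRing R in
    let open WithRing R in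
    (k : ℕ) → 2 ≤ k →
    (p q r : Carrier) →
    (ifac : ℕ → Carrier) → (∀ n → ifac n * qfact p q n ≈ 1#) →
    ∀ n → conv (lhsSeries k p q r ifac) (denSeries k p q r ifac) n ≈ oneSeries n
-- The identity holds for every k.
corollary12 R k _ p q r ifac ifac-inverse = conv-lhsSeries-denSeries R k p q r ifac ifac-inverse
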